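{- Let $m,n$ be positive integers with $n\equiv 0\pmod 2$. Then $\Phi(m\times n,3,1)\le J^*(m\times n,3,1)$.
   Context: Let $I_m=\{0,1,\dots,m-1\}$ and $\mathbb{Z}_n$ the integers modulo $n$. A $2$-D $(m\times n,k,1)$-OOC is a set $\mathcal{C}$ of $k$-subsets of $I_m\times\mathbb{Z}_n$ such that $|A\cap(A+\tau)|\le 1$ for every $A\in\mathcal{C}$ and every integer $\tau\not\equiv 0\pmod n$, and $|A\cap(B+\tau)|\le 1$ for all distinct $A,B\in\mathcal{C}$ and every integer $\tau$, where $B+\tau=\{(i,x+\tau \bmod n):(i,x)\in B\}$. $\Phi(m\times n,k,1)$ denotes the largest possible number of codewords of such a code. $J(m\times n,3,1)=\left\lfloor \frac{m}{3}\left\lfloor\frac{mn-1}{2}\right\rfloor\right\rfloor$. For even $n$, $J^*(m\times n,3,1)=J(m\times n,3,1)-1$ if $mn\equiv 14,20\pmod{24}$, or $m\equiv 4\pmod 6$ and $n=4$, or $m\equiv 5,8\pmod{12}$ and $n=2$, or $m\equiv 0\pmod 3$ and $mn\equiv 6,12\pmod{24}$; and $J^*(m\times n,3,1)=J(m\times n,3,1)$ otherwise. -}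

module Defs where

open import Data.Nat using (ℕ; zero; suc; _+_; _*_; _∸_; _≤_; _≡ᵇ_; NonZero)
open import Data.Nat.DivMod using (_/_; _%_; m%n<n)
open import Data.Bool using (Bool; true; false; _∧_; _∨_; if_then_else_)
open import Data.Fin using (Fin; toℕ; fromℕ<)
open import Data.List using (List; map; allFin)
open import Data.Nat.ListAction using (sum)
open import Relation.Binary.PropositionalEquality using (_≡_; _≢_)
open import Relation.Nullary using (¬_)

count : ∀ {k} → (Fin k → Bool) → ℕ
count {k} P = sum (map (λ x → if P x then 1 else 0) (allFin k))

-- a subset of I_m × Z_n, given by its characteristic function
SubsetIZ : ℕ → ℕ → Set
SubsetIZ m n = Fin m → Fin n → Bool

card : ∀ {m n} → SubsetIZ m n → ℕ
card {m} A = sum (map (λ i → count (A i)) (allFin m))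

_⊕_ : ∀ {n} → Fin n → ℕ → Fin n
_⊕_ {suc n} x τ = fromℕ< (m%n<n (toℕ x + τ) (suc n))

-- |A ∩ (B + τ)| : counts the points (i,y) ∈ B with (i, y+τ) ∈ A,
-- i.e. the points of B whose translate lies in A (bijective with A ∩ (B+τ))
interSize : ∀ {m n} → SubsetIZ m n → SubsetIZ m n → Fin n → ℕ
interSize {m} A B τ = sum (map (λ i → count (λ y → B i y ∧ A i (y ⊕ toℕ τ))) (allFin m))

-- A code with N codewords, indexed by Fin N, is a 2-D (m×n,k,1)-OOC.
-- Shifts τ are taken in Z_n (only τ mod n matters); τ ≢ 0 mod n means τ ≠ 0 in Fin n.
record IsOOC (m n k N : ℕ) (C : Fin N → SubsetIZ m n) : Set where
  field
    size    : ∀ a → card (C a) ≡ k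
    autoCor : ∀ a (τ : Fin n) → toℕ τ ≢ 0 → interSize (C a) (C a) τ ≤ 1
    crossCor : ∀ a b → a ≢ b → ∀ (τ : Fin n) → interSize (C a) (C b) τ ≤ 1

J : ℕ → ℕ → ℕ
J m n = (m * ((m * n ∸ 1) / 2)) / 3

exceptional : ℕ → ℕ → Bool
exceptional m n =
  ((m * n % 24 ≡ᵇ 14) ∨ (m * n % 24 ≡ᵇ 20))
  ∨ ((m % 6 ≡ᵇ 4) ∧ (n ≡ᵇ 4))
  ∨ (((m % 12 ≡ᵇ 5) ∨ (m % 12 ≡ᵇ 8)) ∧ (n ≡ᵇ 2))
  ∨ ((m % 3 ≡ᵇ 0) ∧ ((m * n % 24 ≡ᵇ 6) ∨ (m * n % 24 ≡ᵇ 12)))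

Jstar : ℕ → ℕ → ℕ
Jstar m n = if exceptional m n then J m n ∸ 1 else J m n

{-# OPTIONS --safe #-}
-- Double counting of differences. A codeword A gives 9 ordered pairs of its points
-- (i, x), (j, x + d), i.e. differences (i, j, d). Three of them are trivial (i = j, d = 0),
-- (i, i, n/2) cannot occur since it would make A + n/2 meet A twice, and by the correlation
-- constraints no other difference occurs twice in the whole code. With n = 2h this leaves
-- at most m²n - 2m positions for 6N differences, i.e. N ≤ J = ⌊m(mh - 1)/3⌋, and if N = J the
-- number of uncovered positions is ℓ = 2 (m(mh - 1) mod 3).
-- Counting odd d: a codeword with e points of even and o of odd second coordinate has
-- 2eo ≡ 0 (mod 4) odd differences since e + o = 3, which fixes the uncovered odd count mod 4.
-- Uncovered positions are closed under (i, j, d) ↦ (j, i, -d) and every row has an even number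
-- of off-row uncovered positions; for n = 4, ℓ = 2 and n = 2, ℓ = 4 this forces exactly two odd
-- ones. In each exceptional case these congruences are inconsistent, which is checked by
-- evaluation over residues mod 12.
module Submission where

open import Defs
open import Data.Nat using (ℕ; zero; suc; _+_; _*_; _∸_; _≤_; _<_; z≤n; s≤s; _%_; _/_; _≡ᵇ_; _≤?_; NonZero)
open import Data.Nat.Properties
open import Data.Nat.Divisibility using (_∣_; divides; _∣0; ∣m∣n⇒∣m+n; ∣m+n∣m⇒∣n; ∣n⇒∣m*n)
open import Data.Nat.DivMod
  using (m%n<n; m≡m%n+[m/n]*n; /-monoˡ-≤; %-remove-+ʳ; m<n⇒m%n≡m; [m+kn]%n≡m%n; %-distribˡ-+; %-distribˡ-*;
         m%n%n≡m%n; m∣n⇒o%n%m≡o%m; +-distrib-/; m*n%n≡0; m*n/n≡m; m%n*o≡m*o%[n*o])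
import Data.Nat.ListAction as List
open import Data.Bool using (Bool; true; false; if_then_else_; _∧_; _∨_; not; T)
open import Data.Fin using (Fin; toℕ; fromℕ<) renaming (zero to fzero; suc to fsuc)
open import Data.Fin.Properties using (toℕ-injective; toℕ-fromℕ<; toℕ<n)
  renaming (suc-injective to fsuc-injective; _≟_ to _≟ᶠ_)
open import Data.Fin.Permutation using (permutation)
open import Data.List using (map; allFin; tabulate)
open import Data.List.Properties using (map-tabulate)
open import Data.Product using (∃; ∃₂; _×_; _,_; proj₁; proj₂)
open import Data.Sum using (_⊎_; inj₁; inj₂)
open import Data.Empty using (⊥; ⊥-elim)
open import Data.Unit using (tt)
open import Function using (id; _∘_)
open import Relation.Binary.PropositionalEquality hiding (J)
open import Relation.Nullary using (¬_; Dec; yes; no; does; ¬?)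
open import Relation.Nullary.Decidable using (dec-true; dec-false; from-yes; _×-dec_; _→-dec_; T?)
open import Data.Nat.Tactic.RingSolver using (solve-∀)
open import Algebra.Properties.Semiring.Sum +-*-semiring
  using (sum; sum-syntax; sum-cong-≗; ∑-distrib-+; ∑-comm; *-distribˡ-sum; *-distribʳ-sum; sum-permute)

open ≡-Reasoning

sum-allFin : ∀ {k} (f : Fin k → ℕ) → List.sum (map f (allFin k)) ≡ sum f
sum-allFin f = trans (cong List.sum (map-tabulate id f)) (sum-tabulate f)
  where
  sum-tabulate : ∀ {k} (f : Fin k → ℕ) → List.sum (tabulate f) ≡ sum f
  sum-tabulate {zero}  f = refl
  sum-tabulate {suc k} f = cong (f fzero +_) (sum-tabulate (f ∘ fsuc))

sum-const : ∀ k c → ∑[ x < k ] c ≡ k * c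
sum-const zero    c = refl
sum-const (suc k) c = cong (c +_) (sum-const k c)

sum-zero : ∀ {k} (f : Fin k → ℕ) → (∀ x → f x ≡ 0) → sum f ≡ 0
sum-zero {k} f f≡0 = trans (sum-cong-≗ f≡0) (trans (sum-const k 0) (*-zeroʳ k))

sum-mono-≤ : ∀ {k} {f g : Fin k → ℕ} → (∀ x → f x ≤ g x) → sum f ≤ sum g
sum-mono-≤ {zero}  f≤g = z≤n
sum-mono-≤ {suc k} f≤g = +-mono-≤ (f≤g fzero) (sum-mono-≤ (f≤g ∘ fsuc))

term≤sum : ∀ {k} (f : Fin k → ℕ) x → f x ≤ sum f
term≤sum f fzero    = m≤m+n (f fzero) _
term≤sum f (fsuc x) = ≤-trans (term≤sum (f ∘ fsuc) x) (m≤n+m _ (f fzero))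

two-terms≤sum : ∀ {k} (f : Fin k → ℕ) {x y} → x ≢ y → f x + f y ≤ sum f
two-terms≤sum f {fzero}  {fzero}  x≢y = ⊥-elim (x≢y refl)
two-terms≤sum f {fzero}  {fsuc y} x≢y = +-monoʳ-≤ (f fzero) (term≤sum (f ∘ fsuc) y)
two-terms≤sum f {fsuc x} {fzero}  x≢y =
  subst (_≤ sum f) (+-comm (f fzero) (f (fsuc x))) (+-monoʳ-≤ (f fzero) (term≤sum (f ∘ fsuc) x))
two-terms≤sum f {fsuc x} {fsuc y} x≢y =
  ≤-trans (two-terms≤sum (f ∘ fsuc) (x≢y ∘ cong fsuc)) (m≤n+m _ (f fzero))

sum-positive : ∀ {k} (f : Fin k → ℕ) → 0 < sum f → ∃ λ x → 0 < f x
sum-positive {suc k} f 0<∑ with f fzero in eq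
... | suc _ = fzero , subst (0 <_) (sym eq) (s≤s z≤n)
... | zero  = let x , 0<fx = sum-positive (f ∘ fsuc) 0<∑ in fsuc x , 0<fx

sum≤1 : ∀ {k} (f : Fin k → ℕ) → (∀ x → f x ≤ 1) →
        (∀ {x y} → x ≢ y → 0 < f x → 0 < f y → ⊥) → sum f ≤ 1
sum≤1 {zero}  f f≤1 disjoint = z≤n
sum≤1 {suc k} f f≤1 disjoint with f fzero in eq
... | zero  = sum≤1 (f ∘ fsuc) (f≤1 ∘ fsuc) (λ x≢y → disjoint (x≢y ∘ fsuc-injective))
... | suc c = ≤-trans (≤-reflexive (trans (cong (suc c +_) (sum-zero (f ∘ fsuc) rest)) (+-identityʳ _)))
                      (subst (_≤ 1) eq (f≤1 fzero))
  where
  rest : ∀ y → f (fsuc y) ≡ 0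
  rest y with f (fsuc y) in eq′
  ... | zero  = refl
  ... | suc _ = ⊥-elim (disjoint {fzero} {fsuc y} (λ ()) (subst (0 <_) (sym eq) (s≤s z≤n))
                                                       (subst (0 <_) (sym eq′) (s≤s z≤n)))

sum-product : ∀ {k l} (f : Fin k → ℕ) (g : Fin l → ℕ) → ∑[ x < k ] ∑[ y < l ] (f x * g y) ≡ sum f * sum g
sum-product f g = begin
  ∑[ x < _ ] ∑[ y < _ ] (f x * g y)   ≡⟨ sum-cong-≗ (λ x → *-distribˡ-sum (f x) g) ⟨
  ∑[ x < _ ] (f x * sum g)            ≡⟨ *-distribʳ-sum (sum g) f ⟨
  sum f * sum g                     ∎

sum²-distrib-+ : ∀ {k l} (f g : Fin k → Fin l → ℕ) →
                 ∑[ x < k ] ∑[ y < l ] (f x y + g x y) ≡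
                 ∑[ x < k ] ∑[ y < l ] f x y + ∑[ x < k ] ∑[ y < l ] g x y
sum²-distrib-+ f g =
  trans (sum-cong-≗ (λ x → ∑-distrib-+ (f x) (g x))) (∑-distrib-+ (λ x → sum (f x)) (λ x → sum (g x)))

∣-sum : ∀ {d k} (f : Fin k → ℕ) → (∀ x → d ∣ f x) → d ∣ sum f
∣-sum {d} {zero}  f d∣f = d ∣0
∣-sum {d} {suc k} f d∣f = ∣m∣n⇒∣m+n (d∣f fzero) (∣-sum (f ∘ fsuc) (d∣f ∘ fsuc))

𝟙 : Bool → ℕ
𝟙 b = if b then 1 else 0

same distinct : ∀ {k} → Fin k → Fin k → ℕ
same     x y = 𝟙 (does (x ≟ᶠ y))
distinct x y = 𝟙 (not (does (x ≟ᶠ y)))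

same≤1 : ∀ {k} (x y : Fin k) → same x y ≤ 1
same≤1 x y with does (x ≟ᶠ y)
... | true  = s≤s z≤n
... | false = z≤n

same-≢ : ∀ {k} {x y : Fin k} → x ≢ y → same x y ≡ 0
same-≢ {x = x} {y} x≢y = cong 𝟙 (dec-false (x ≟ᶠ y) x≢y)

same-refl : ∀ {k} (x : Fin k) → same x x ≡ 1
same-refl x = cong 𝟙 (dec-true (x ≟ᶠ x) refl)

distinct-refl : ∀ {k} (x : Fin k) → distinct x x ≡ 0
distinct-refl x = cong (𝟙 ∘ not) (dec-true (x ≟ᶠ x) refl)

distinct-≢ : ∀ {k} {x y : Fin k} → x ≢ y → distinct x y ≡ 1
distinct-≢ {x = x} {y} x≢y = cong (𝟙 ∘ not) (dec-false (x ≟ᶠ y) x≢y)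

distinct-positive : ∀ {k} {x y : Fin k} → 0 < distinct x y → x ≢ y
distinct-positive {x = x} 0<d refl = <-irrefl (sym (distinct-refl x)) 0<d

same+distinct : ∀ {k} (x y : Fin k) → same x y + distinct x y ≡ 1
same+distinct x y with does (x ≟ᶠ y)
... | true  = refl
... | false = refl

distinct-*-cong : ∀ {k} (x : Fin k) {f g : Fin k → ℕ} → (∀ y → x ≢ y → f y ≡ g y) →
                  ∀ {y} → distinct x y * f y ≡ distinct x y * g y
distinct-*-cong x f≡g {y} with x ≟ᶠ y
... | yes refl = refl
... | no x≢y   = cong (1 *_) (f≡g y x≢y)

sum-same : ∀ {k} (x : Fin k) (f : Fin k → ℕ) → ∑[ y < k ] (same x y * f y) ≡ f x
sum-same fzero    f =
  trans (cong₂ _+_ (+-identityʳ (f fzero)) (sum-zero (λ y → same fzero (fsuc y) * f (fsuc y)) (λ _ → refl)))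
        (+-identityʳ (f fzero))
sum-same (fsuc x) f = sum-same x (f ∘ fsuc)

sum-split-at : ∀ {k} (x : Fin k) (f : Fin k → ℕ) → sum f ≡ f x + ∑[ y < k ] (distinct x y * f y)
sum-split-at {k} x f = begin
  sum f                                                   ≡⟨ sum-cong-≗ split ⟩
  ∑[ y < _ ] (same x y * f y + distinct x y * f y)        ≡⟨ ∑-distrib-+ (λ y → same x y * f y) _ ⟩
  ∑[ y < _ ] (same x y * f y) + ∑[ y < _ ] (distinct x y * f y)
                                                          ≡⟨ cong (_+ ∑[ y < k ] (distinct x y * f y)) (sum-same x f) ⟩
  f x + ∑[ y < _ ] (distinct x y * f y)                   ∎
  where
  split : ∀ y → f y ≡ same x y * f y + distinct x y * f y
  split y = sym (trans (sym (*-distribʳ-+ (f y) (same x y) _))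
                       (trans (cong (_* f y) (same+distinct x y)) (*-identityˡ (f y))))

three-terms≤sum : ∀ {k} (f : Fin k → ℕ) {x y z} → x ≢ y → x ≢ z → y ≢ z → f x + f y + f z ≤ sum f
three-terms≤sum f {x} {y} {z} x≢y x≢z y≢z =
  subst₂ _≤_ lhs (sym (sum-split-at x f)) (+-monoʳ-≤ (f x) (two-terms≤sum (λ w → distinct x w * f w) y≢z))
  where
  weighted : ∀ {w} → x ≢ w → distinct x w * f w ≡ f w
  weighted {w} x≢w = trans (cong (_* f w) (distinct-≢ x≢w)) (*-identityˡ (f w))
  lhs : f x + (distinct x y * f y + distinct x z * f z) ≡ f x + f y + f z
  lhs = trans (cong (f x +_) (cong₂ _+_ (weighted x≢y) (weighted x≢z))) (sym (+-assoc (f x) (f y) (f z)))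

two-entries≤sum² : ∀ {k} (F : Fin k → Fin k → ℕ) {i j} → i ≢ j → F i j + F j i ≤ ∑[ a < k ] ∑[ b < k ] F a b
two-entries≤sum² F {i} {j} i≢j =
  ≤-trans (+-mono-≤ (term≤sum (F i) j) (term≤sum (F j) i)) (two-terms≤sum (λ a → sum (F a)) i≢j)

∑³ : ∀ {m k} → (Fin m → Fin m → Fin k → ℕ) → ℕ
∑³ {m} {k} F = ∑[ i < m ] ∑[ j < m ] ∑[ d < k ] F i j d

∑³-cong : ∀ {m k} {F G : Fin m → Fin m → Fin k → ℕ} → (∀ i j d → F i j d ≡ G i j d) → ∑³ F ≡ ∑³ G
∑³-cong F≡G = sum-cong-≗ (λ i → sum-cong-≗ (λ j → sum-cong-≗ (F≡G i j)))

∑³-distrib-+ : ∀ {m k} (F G : Fin m → Fin m → Fin k → ℕ) → ∑³ (λ i j d → F i j d + G i j d) ≡ ∑³ F + ∑³ G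
∑³-distrib-+ {m} {k} F G = trans (sum-cong-≗ (λ i → sum²-distrib-+ (F i) (G i)))
                                 (∑-distrib-+ (λ i → ∑[ j < m ] ∑[ d < k ] F i j d) (λ i → ∑[ j < m ] ∑[ d < k ] G i j d))

∑³-mono-≤ : ∀ {m k} {F G : Fin m → Fin m → Fin k → ℕ} → (∀ i j d → F i j d ≤ G i j d) → ∑³ F ≤ ∑³ G
∑³-mono-≤ F≤G = sum-mono-≤ (λ i → sum-mono-≤ (λ j → sum-mono-≤ (F≤G i j)))

∑³-sum : ∀ {m k N} (G : Fin N → Fin m → Fin m → Fin k → ℕ) →
         ∑³ (λ i j d → ∑[ a < N ] G a i j d) ≡ ∑[ a < N ] ∑³ (G a)
∑³-sum {m} {k} {N} G = begin
  ∑[ i < m ] ∑[ j < m ] ∑[ d < k ] ∑[ a < N ] G a i j d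
    ≡⟨ sum-cong-≗ (λ i → sum-cong-≗ (λ j → ∑-comm (λ d a → G a i j d))) ⟩
  ∑[ i < m ] ∑[ j < m ] ∑[ a < N ] ∑[ d < k ] G a i j d
    ≡⟨ sum-cong-≗ (λ i → ∑-comm (λ j a → ∑[ d < k ] G a i j d)) ⟩
  ∑[ i < m ] ∑[ a < N ] ∑[ j < m ] ∑[ d < k ] G a i j d
    ≡⟨ ∑-comm (λ i a → ∑[ j < m ] ∑[ d < k ] G a i j d) ⟩
  ∑[ a < N ] ∑³ (G a)
    ∎

∑³-row : ∀ m {k} (f : Fin k → ℕ) → ∑³ {m} (λ _ _ d → f d) ≡ m * (m * sum f)
∑³-row m f = begin
  ∑[ i < m ] ∑[ j < m ] sum f    ≡⟨ cong (λ v → ∑[ i < m ] v) (sum-const m (sum f)) ⟩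
  ∑[ i < m ] (m * sum f)         ≡⟨ sum-const m (m * sum f) ⟩
  m * (m * sum f)                ∎

%-absorbˡ : ∀ a b d .{{_ : NonZero d}} → (a % d + b) % d ≡ (a + b) % d
%-absorbˡ a b d = begin
  (a % d + b) % d             ≡⟨ %-distribˡ-+ (a % d) b d ⟩
  (a % d % d + b % d) % d     ≡⟨ cong (λ r → (r + b % d) % d) (m%n%n≡m%n a d) ⟩
  (a % d + b % d) % d         ≡⟨ %-distribˡ-+ a b d ⟨
  (a + b) % d                 ∎

%-absorbʳ : ∀ a b d .{{_ : NonZero d}} → (a + b % d) % d ≡ (a + b) % d
%-absorbʳ a b d = begin
  (a + b % d) % d  ≡⟨ cong (_% d) (+-comm a (b % d)) ⟩
  (b % d + a) % d  ≡⟨ %-absorbˡ b a d ⟩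
  (b + a) % d      ≡⟨ cong (_% d) (+-comm b a) ⟩
  (a + b) % d      ∎

%-cong-+ : ∀ {a a′ b b′} d .{{_ : NonZero d}} → a % d ≡ a′ % d → b % d ≡ b′ % d → (a + b) % d ≡ (a′ + b′) % d
%-cong-+ {a} {a′} {b} {b′} d a≡a′ b≡b′ = begin
  (a + b) % d               ≡⟨ %-distribˡ-+ a b d ⟩
  (a % d + b % d) % d       ≡⟨ cong₂ (λ u v → (u + v) % d) a≡a′ b≡b′ ⟩
  (a′ % d + b′ % d) % d     ≡⟨ %-distribˡ-+ a′ b′ d ⟨
  (a′ + b′) % d             ∎

%-cong-* : ∀ {a a′ b b′} d .{{_ : NonZero d}} → a % d ≡ a′ % d → b % d ≡ b′ % d → (a * b) % d ≡ (a′ * b′) % d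
%-cong-* {a} {a′} {b} {b′} d a≡a′ b≡b′ = begin
  (a * b) % d               ≡⟨ %-distribˡ-* a b d ⟩
  (a % d * (b % d)) % d     ≡⟨ cong₂ (λ u v → (u * v) % d) a≡a′ b≡b′ ⟩
  (a′ % d * (b′ % d)) % d   ≡⟨ %-distribˡ-* a′ b′ d ⟨
  (a′ * b′) % d             ∎

a+a≡a*2 : ∀ a → a + a ≡ a * 2
a+a≡a*2 = solve-∀

double-injective : ∀ a b → a + a ≡ b + b → a ≡ b
double-injective a b eq = *-cancelʳ-≡ a b 2 (trans (sym (a+a≡a*2 a)) (trans eq (a+a≡a*2 b)))

2∣product-of-split-3 : ∀ a b → a + b ≡ 3 → 2 ∣ a * b
2∣product-of-split-3 0 b _ = divides 0 refl
2∣product-of-split-3 1 2 _ = divides 1 refl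
2∣product-of-split-3 2 1 _ = divides 1 refl
2∣product-of-split-3 3 0 _ = divides 0 refl
2∣product-of-split-3 1 0 ()
2∣product-of-split-3 1 1 ()
2∣product-of-split-3 1 (suc (suc (suc _))) ()
2∣product-of-split-3 2 0 ()
2∣product-of-split-3 2 (suc (suc _)) ()
2∣product-of-split-3 3 (suc _) ()
2∣product-of-split-3 (suc (suc (suc (suc _)))) _ ()

2∣ab⇒4∣ab+ba : ∀ {a b} → 2 ∣ a * b → 4 ∣ a * b + b * a
2∣ab⇒4∣ab+ba {a} {b} (divides q ab≡q*2) = divides q (begin
  a * b + b * a   ≡⟨ cong (a * b +_) (*-comm b a) ⟩
  a * b + a * b   ≡⟨ cong (λ r → r + r) ab≡q*2 ⟩
  q * 2 + q * 2   ≡⟨ double q ⟩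
  q * 4           ∎)
  where
  double : ∀ q → q * 2 + q * 2 ≡ q * 4
  double = solve-∀

even-positive⇒≥2 : ∀ {a} → 2 ∣ a → 0 < a → 2 ≤ a
even-positive⇒≥2 (divides (suc q) refl) _ = s≤s (s≤s z≤n)

*-positive : ∀ a b → 0 < a * b → 0 < a × 0 < b
*-positive (suc a) (suc b) _   = s≤s z≤n , s≤s z≤n
*-positive (suc a) zero    0<p = ⊥-elim (<-irrefl refl (subst (0 <_) (*-zeroʳ a) 0<p))

both-positive : ∀ {a b} → a ≤ 1 → b ≤ 1 → 2 ≤ a + b → 0 < a × 0 < b
both-positive {suc _}        {suc _}        _        _        _           = s≤s z≤n , s≤s z≤n
both-positive {zero}         {suc zero}     _        _        (s≤s ())
both-positive {zero}         {suc (suc _)}  _        (s≤s ()) _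
both-positive {suc zero}     {zero}         _        _        (s≤s ())
both-positive {suc (suc _)}  {zero}         (s≤s ()) _        _

%2-suc : ∀ a → suc a % 2 ≡ 1 ∸ a % 2
%2-suc 0             = refl
%2-suc 1             = refl
%2-suc (suc (suc a)) = %2-suc a

%2-+ : ∀ a b → (a + b) % 2 ≡ a % 2 * (1 ∸ b % 2) + (1 ∸ a % 2) * (b % 2)
%2-+ 0             b = sym (+-identityʳ (b % 2))
%2-+ 1             b = trans (%2-suc b) (sym (trans (+-identityʳ _) (+-identityʳ _)))
%2-+ (suc (suc a)) b = %2-+ a b

-- Cyclic shifts

module _ {n : ℕ} where

  toℕ-⊕ : (x : Fin (suc n)) (c : ℕ) → toℕ (x ⊕ c) ≡ (toℕ x + c) % suc n
  toℕ-⊕ x c = toℕ-fromℕ< _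

  ⊕-identityʳ : (x : Fin (suc n)) → x ⊕ 0 ≡ x
  ⊕-identityʳ x = toℕ-injective (begin
    toℕ (x ⊕ 0)           ≡⟨ toℕ-⊕ x 0 ⟩
    (toℕ x + 0) % suc n   ≡⟨ cong (_% suc n) (+-identityʳ (toℕ x)) ⟩
    toℕ x % suc n         ≡⟨ m<n⇒m%n≡m (toℕ<n x) ⟩
    toℕ x                 ∎)

  ⊕-assoc : (x : Fin (suc n)) (a b : ℕ) → (x ⊕ a) ⊕ b ≡ x ⊕ (a + b)
  ⊕-assoc x a b = toℕ-injective (begin
    toℕ ((x ⊕ a) ⊕ b)               ≡⟨ toℕ-⊕ (x ⊕ a) b ⟩
    (toℕ (x ⊕ a) + b) % suc n       ≡⟨ cong (λ r → (r + b) % suc n) (toℕ-⊕ x a) ⟩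
    ((toℕ x + a) % suc n + b) % suc n ≡⟨ %-absorbˡ (toℕ x + a) b (suc n) ⟩
    (toℕ x + a + b) % suc n         ≡⟨ cong (_% suc n) (+-assoc (toℕ x) a b) ⟩
    (toℕ x + (a + b)) % suc n       ≡⟨ toℕ-⊕ x (a + b) ⟨
    toℕ (x ⊕ (a + b))               ∎)

  ⊕-toℕ-comm : (x y : Fin (suc n)) → x ⊕ toℕ y ≡ y ⊕ toℕ x
  ⊕-toℕ-comm x y = toℕ-injective (begin
    toℕ (x ⊕ toℕ y)             ≡⟨ toℕ-⊕ x (toℕ y) ⟩
    (toℕ x + toℕ y) % suc n     ≡⟨ cong (_% suc n) (+-comm (toℕ x) (toℕ y)) ⟩
    (toℕ y + toℕ x) % suc n     ≡⟨ toℕ-⊕ y (toℕ x) ⟨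
    toℕ (y ⊕ toℕ x)             ∎)

  ⊕-toℕ-⊕ : (x y : Fin (suc n)) (c : ℕ) → x ⊕ toℕ (y ⊕ c) ≡ (x ⊕ toℕ y) ⊕ c
  ⊕-toℕ-⊕ x y c = toℕ-injective (begin
    toℕ (x ⊕ toℕ (y ⊕ c))                 ≡⟨ toℕ-⊕ x _ ⟩
    (toℕ x + toℕ (y ⊕ c)) % suc n         ≡⟨ cong (λ r → (toℕ x + r) % suc n) (toℕ-⊕ y c) ⟩
    (toℕ x + (toℕ y + c) % suc n) % suc n ≡⟨ %-absorbʳ (toℕ x) (toℕ y + c) (suc n) ⟩
    (toℕ x + (toℕ y + c)) % suc n         ≡⟨ cong (_% suc n) (+-assoc (toℕ x) (toℕ y) c) ⟨
    (toℕ x + toℕ y + c) % suc n           ≡⟨ %-absorbˡ (toℕ x + toℕ y) c (suc n) ⟨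
    ((toℕ x + toℕ y) % suc n + c) % suc n ≡⟨ cong (λ r → (r + c) % suc n) (toℕ-⊕ x (toℕ y)) ⟨
    (toℕ (x ⊕ toℕ y) + c) % suc n         ≡⟨ toℕ-⊕ (x ⊕ toℕ y) c ⟨
    toℕ ((x ⊕ toℕ y) ⊕ c)                 ∎)

  ⊕-multiple : (x : Fin (suc n)) (c : ℕ) → x ⊕ (c * suc n) ≡ x
  ⊕-multiple x c = toℕ-injective (begin
    toℕ (x ⊕ (c * suc n))         ≡⟨ toℕ-⊕ x (c * suc n) ⟩
    (toℕ x + c * suc n) % suc n   ≡⟨ [m+kn]%n≡m%n (toℕ x) c (suc n) ⟩
    toℕ x % suc n                 ≡⟨ m<n⇒m%n≡m (toℕ<n x) ⟩
    toℕ x                         ∎)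

  -- c * n is an additive inverse of c modulo n + 1.
  ⊕-inverseʳ : (x : Fin (suc n)) (c : ℕ) → (x ⊕ c) ⊕ (c * n) ≡ x
  ⊕-inverseʳ x c = begin
    (x ⊕ c) ⊕ (c * n)   ≡⟨ ⊕-assoc x c (c * n) ⟩
    x ⊕ (c + c * n)     ≡⟨ cong (x ⊕_) (*-suc c n) ⟨
    x ⊕ (c * suc n)     ≡⟨ ⊕-multiple x c ⟩
    x                   ∎

  ⊕-inverseˡ : (x : Fin (suc n)) (c : ℕ) → (x ⊕ (c * n)) ⊕ c ≡ x
  ⊕-inverseˡ x c = begin
    (x ⊕ (c * n)) ⊕ c   ≡⟨ ⊕-assoc x (c * n) c ⟩
    x ⊕ (c * n + c)     ≡⟨ cong (x ⊕_) (+-comm (c * n) c) ⟩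
    x ⊕ (c + c * n)     ≡⟨ ⊕-assoc x c (c * n) ⟨
    (x ⊕ c) ⊕ (c * n)   ≡⟨ ⊕-inverseʳ x c ⟩
    x                   ∎

  ⊕-swap : (x : Fin (suc n)) (a b : ℕ) → (x ⊕ a) ⊕ b ≡ (x ⊕ b) ⊕ a
  ⊕-swap x a b = trans (⊕-assoc x a b) (trans (cong (x ⊕_) (+-comm a b)) (sym (⊕-assoc x b a)))

  sum-shift : (c : ℕ) (f : Fin (suc n) → ℕ) → ∑[ x < suc n ] f (x ⊕ c) ≡ sum f
  sum-shift c f =
    sym (sum-permute f (permutation (_⊕ c) (_⊕ (c * n)) (λ x → ⊕-inverseˡ x c) (λ x → ⊕-inverseʳ x c)))

  _⊖_ : Fin (suc n) → Fin (suc n) → Fin (suc n)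
  y ⊖ x = y ⊕ (toℕ x * n)

  ⊕-⊖ : (x y : Fin (suc n)) → x ⊕ toℕ (y ⊖ x) ≡ y
  ⊕-⊖ x y = begin
    x ⊕ toℕ (y ⊕ (toℕ x * n))   ≡⟨ ⊕-toℕ-⊕ x y (toℕ x * n) ⟩
    (x ⊕ toℕ y) ⊕ (toℕ x * n)   ≡⟨ cong (_⊕ (toℕ x * n)) (⊕-toℕ-comm x y) ⟩
    (y ⊕ toℕ x) ⊕ (toℕ x * n)   ≡⟨ ⊕-inverseʳ y (toℕ x) ⟩
    y                           ∎

  ⊖≢0 : {x y : Fin (suc n)} → y ≢ x → toℕ (y ⊖ x) ≢ 0
  ⊖≢0 {x} {y} y≢x d≡0 = y≢x (begin
    y                   ≡⟨ ⊕-⊖ x y ⟨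
    x ⊕ toℕ (y ⊖ x)     ≡⟨ cong (x ⊕_) d≡0 ⟩
    x ⊕ 0               ≡⟨ ⊕-identityʳ x ⟩
    x                   ∎)

  ⊕-fixed⇒0 : (x d : Fin (suc n)) → x ⊕ toℕ d ≡ x → toℕ d ≡ 0
  ⊕-fixed⇒0 x d x+d≡x = cong toℕ (begin
    d                               ≡⟨ ⊕-inverseʳ d (toℕ x) ⟨
    (d ⊕ toℕ x) ⊕ (toℕ x * n)       ≡⟨ cong (_⊕ (toℕ x * n)) (trans (⊕-toℕ-comm d x) x+d≡x) ⟩
    x ⊕ (toℕ x * n)                 ≡⟨ cong (_⊕ (toℕ x * n)) (trans (⊕-toℕ-comm fzero x) (⊕-identityʳ x)) ⟨
    (fzero ⊕ toℕ x) ⊕ (toℕ x * n)   ≡⟨ ⊕-inverseʳ fzero (toℕ x) ⟩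
    fzero                           ∎)

  -_ : Fin (suc n) → Fin (suc n)
  - d = fzero ⊖ d

  ⊕-negʳ : (x d : Fin (suc n)) → (x ⊕ toℕ d) ⊕ toℕ (- d) ≡ x
  ⊕-negʳ x d = begin
    (x ⊕ toℕ d) ⊕ toℕ (fzero ⊕ (toℕ d * n))   ≡⟨ ⊕-toℕ-⊕ (x ⊕ toℕ d) fzero (toℕ d * n) ⟩
    ((x ⊕ toℕ d) ⊕ 0) ⊕ (toℕ d * n)           ≡⟨ cong (_⊕ (toℕ d * n)) (⊕-identityʳ (x ⊕ toℕ d)) ⟩
    (x ⊕ toℕ d) ⊕ (toℕ d * n)                 ≡⟨ ⊕-inverseʳ x (toℕ d) ⟩
    x                                         ∎

  ⊕-parity : 2 ∣ suc n → (x : Fin (suc n)) (c : ℕ) → toℕ (x ⊕ c) % 2 ≡ (toℕ x + c) % 2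
  ⊕-parity 2∣n x c = trans (cong (_% 2) (toℕ-⊕ x c)) (m∣n⇒o%n%m≡o%m 2 (suc n) (toℕ x + c) 2∣n)

  ⊕-half-involutive : ∀ h → suc n ≡ h + h → (x : Fin (suc n)) → (x ⊕ h) ⊕ h ≡ x
  ⊕-half-involutive h n≡h+h x = begin
    (x ⊕ h) ⊕ h       ≡⟨ ⊕-assoc x h h ⟩
    x ⊕ (h + h)       ≡⟨ cong (x ⊕_) (trans (sym n≡h+h) (sym (*-identityˡ (suc n)))) ⟩
    x ⊕ (1 * suc n)   ≡⟨ ⊕-multiple x 1 ⟩
    x                 ∎

odd even : ∀ {k} → Fin k → ℕ
odd  x = toℕ x % 2
even x = 1 ∸ odd x

odd+even≡1 : ∀ {k} (x : Fin k) → odd x + even x ≡ 1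
odd+even≡1 x = m+[n∸m]≡n (≤-pred (m%n<n (toℕ x) 2))

odd-difference : ∀ {n} → 2 ∣ suc n → (x d : Fin (suc n)) →
                 odd d ≡ odd x * even (x ⊕ toℕ d) + even x * odd (x ⊕ toℕ d)
odd-difference 2∣n x d = begin
  toℕ d % 2                                ≡⟨ [m+kn]%n≡m%n (toℕ d) (toℕ x) 2 ⟨
  (toℕ d + toℕ x * 2) % 2                  ≡⟨ cong (_% 2) (rearrange (toℕ x) (toℕ d)) ⟩
  (toℕ x + (toℕ x + toℕ d)) % 2            ≡⟨ %-absorbʳ (toℕ x) (toℕ x + toℕ d) 2 ⟨
  (toℕ x + (toℕ x + toℕ d) % 2) % 2        ≡⟨ cong (λ r → (toℕ x + r) % 2) (⊕-parity 2∣n x (toℕ d)) ⟨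
  (toℕ x + toℕ (x ⊕ toℕ d) % 2) % 2        ≡⟨ %-absorbʳ (toℕ x) (toℕ (x ⊕ toℕ d)) 2 ⟩
  (toℕ x + toℕ (x ⊕ toℕ d)) % 2            ≡⟨ %2-+ (toℕ x) (toℕ (x ⊕ toℕ d)) ⟩
  odd x * even (x ⊕ toℕ d) + even x * odd (x ⊕ toℕ d) ∎
  where
  rearrange : ∀ u v → v + u * 2 ≡ u + (u + v)
  rearrange = solve-∀

*odd≤ : ∀ {k} a (d : Fin k) → a * odd d ≤ a
*odd≤ a d = ≤-trans (*-monoʳ-≤ a (≤-pred (m%n<n (toℕ d) 2))) (≤-reflexive (*-identityʳ a))

odd+odd-next : ∀ {n} → 2 ∣ suc n → (d : Fin (suc n)) → odd d + odd (d ⊕ 1) ≡ 1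
odd+odd-next 2∣n d = begin
  toℕ d % 2 + toℕ (d ⊕ 1) % 2      ≡⟨ cong (toℕ d % 2 +_) (⊕-parity 2∣n d 1) ⟩
  toℕ d % 2 + (toℕ d + 1) % 2      ≡⟨ cong (λ a → toℕ d % 2 + a % 2) (+-comm (toℕ d) 1) ⟩
  toℕ d % 2 + suc (toℕ d) % 2      ≡⟨ cong (toℕ d % 2 +_) (%2-suc (toℕ d)) ⟩
  toℕ d % 2 + (1 ∸ toℕ d % 2)      ≡⟨ m+[n∸m]≡n (≤-pred (m%n<n (toℕ d) 2)) ⟩
  1                                ∎

∑odd : ∀ {n} h → suc n ≡ h + h → ∑[ d < suc n ] odd d ≡ h
∑odd {n} h n≡h+h = double-injective (∑[ d < suc n ] odd d) h (begin
  ∑[ d < suc n ] odd d + ∑[ d < suc n ] odd d          ≡⟨ cong (∑[ d < suc n ] odd d +_) (sum-shift 1 (odd {suc n})) ⟨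
  ∑[ d < suc n ] odd d + ∑[ d < suc n ] odd (d ⊕ 1)    ≡⟨ ∑-distrib-+ (odd {suc n}) (λ d → odd (d ⊕ 1)) ⟨
  ∑[ d < suc n ] (odd d + odd (d ⊕ 1))                 ≡⟨ sum-cong-≗ (odd+odd-next 2∣n) ⟩
  ∑[ d < suc n ] 1                                     ≡⟨ trans (sum-const (suc n) 1) (*-identityʳ (suc n)) ⟩
  suc n                                                ≡⟨ n≡h+h ⟩
  h + h                                                ∎)
  where
  2∣n : 2 ∣ suc n
  2∣n = divides h (trans n≡h+h (a+a≡a*2 h))

-- Differences of a subset of Iₘ × ℤₙ

𝟙-∧ : ∀ a b → 𝟙 (a ∧ b) ≡ 𝟙 a * 𝟙 b
𝟙-∧ true  b = sym (+-identityʳ (𝟙 b))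
𝟙-∧ false b = refl

𝟙-idem : ∀ a → 𝟙 a * 𝟙 a ≡ 𝟙 a
𝟙-idem true  = refl
𝟙-idem false = refl

𝟙*𝟙≤1 : ∀ a b → 𝟙 a * 𝟙 b ≤ 1
𝟙*𝟙≤1 true  true  = s≤s z≤n
𝟙*𝟙≤1 true  false = z≤n
𝟙*𝟙≤1 false b     = z≤n

𝟙*𝟙-positive : ∀ a b → 0 < 𝟙 a * 𝟙 b → a ≡ true × b ≡ true
𝟙*𝟙-positive true true _ = refl , refl

Nontrivial : ∀ {m n} → Fin m → Fin m → Fin (suc n) → Set
Nontrivial i j d = ¬ (i ≡ j × toℕ d ≡ 0)

module _ {m n : ℕ} where

  rowSize : SubsetIZ m (suc n) → Fin m → ℕ
  rowSize A i = ∑[ x < suc n ] 𝟙 (A i x)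

  diffCount : SubsetIZ m (suc n) → Fin m → Fin m → Fin (suc n) → ℕ
  diffCount A i j d = ∑[ x < suc n ] (𝟙 (A i x) * 𝟙 (A j (x ⊕ toℕ d)))

  card≡∑rowSize : (A : SubsetIZ m (suc n)) → card A ≡ ∑[ i < m ] rowSize A i
  card≡∑rowSize A = trans (sum-allFin (count ∘ A)) (sum-cong-≗ (λ i → sum-allFin (𝟙 ∘ A i)))

  interSize≡∑ : (A B : SubsetIZ m (suc n)) (τ : Fin (suc n)) →
                interSize A B τ ≡ ∑[ i < m ] ∑[ y < suc n ] (𝟙 (B i y) * 𝟙 (A i (y ⊕ toℕ τ)))
  interSize≡∑ A B τ =
    trans (sum-allFin (λ i → count (λ y → B i y ∧ A i (y ⊕ toℕ τ))))
          (sum-cong-≗ (λ i → trans (sum-allFin (λ y → 𝟙 (B i y ∧ A i (y ⊕ toℕ τ))))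
                                   (sum-cong-≗ (λ y → 𝟙-∧ (B i y) (A i (y ⊕ toℕ τ))))))

  interSize≥2 : (A B : SubsetIZ m (suc n)) (τ : Fin (suc n)) {i j : Fin m} {y y′ : Fin (suc n)} →
                (i , y) ≢ (j , y′) →
                B i y ≡ true → A i (y ⊕ toℕ τ) ≡ true → B j y′ ≡ true → A j (y′ ⊕ toℕ τ) ≡ true →
                2 ≤ interSize A B τ
  interSize≥2 A B τ {i} {j} {y} {y′} points-differ By Ay+τ By′ Ay′+τ =
    subst (2 ≤_) (sym (interSize≡∑ A B τ))
          (subst (_≤ ∑[ i < m ] sum (F i)) (cong₂ _+_ Fiy≡1 Fjy′≡1) two-terms)
    where
    F : Fin m → Fin (suc n) → ℕ
    F l z = 𝟙 (B l z) * 𝟙 (A l (z ⊕ toℕ τ))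
    Fiy≡1 : F i y ≡ 1
    Fiy≡1 rewrite By | Ay+τ = refl
    Fjy′≡1 : F j y′ ≡ 1
    Fjy′≡1 rewrite By′ | Ay′+τ = refl
    two-terms : F i y + F j y′ ≤ ∑[ i < m ] sum (F i)
    two-terms with i ≟ᶠ j
    ... | yes refl = ≤-trans (two-terms≤sum (F i) (points-differ ∘ cong (i ,_))) (term≤sum (sum ∘ F) i)
    ... | no i≢j   = ≤-trans (+-mono-≤ (term≤sum (F i) y) (term≤sum (F j) y′)) (two-terms≤sum (sum ∘ F) i≢j)

  sharedDifference : (A B : SubsetIZ m (suc n)) {i j : Fin m} {d x y : Fin (suc n)} → Nontrivial i j d →
                     A i x ≡ true → A j (x ⊕ toℕ d) ≡ true → B i y ≡ true → B j (y ⊕ toℕ d) ≡ true →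
                     2 ≤ interSize A B (x ⊖ y)
  sharedDifference A B {i} {j} {d} {x} {y} nontrivial Ax Ax+d By By+d =
    interSize≥2 A B (x ⊖ y) points-differ By (subst (λ z → A i z ≡ true) (sym (⊕-⊖ y x)) Ax)
                                     By+d (subst (λ z → A j z ≡ true) (sym translate) Ax+d)
    where
    points-differ : (i , y) ≢ (j , y ⊕ toℕ d)
    points-differ eq = nontrivial (cong proj₁ eq , ⊕-fixed⇒0 y d (sym (cong proj₂ eq)))
    translate : (y ⊕ toℕ d) ⊕ toℕ (x ⊖ y) ≡ x ⊕ toℕ d
    translate = trans (⊕-swap y (toℕ d) _) (cong (_⊕ toℕ d) (⊕-⊖ y x))

  diffCount-positive : (A : SubsetIZ m (suc n)) {i j : Fin m} {d : Fin (suc n)} → 0 < diffCount A i j d →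
                       ∃ λ x → A i x ≡ true × A j (x ⊕ toℕ d) ≡ true
  diffCount-positive A {i} {j} {d} 0<count =
    let x , 0<term = sum-positive (λ x → 𝟙 (A i x) * 𝟙 (A j (x ⊕ toℕ d))) 0<count
    in  x , 𝟙*𝟙-positive (A i x) _ 0<term

  AutoCorrelation≤1 : SubsetIZ m (suc n) → Set
  AutoCorrelation≤1 A = ∀ (τ : Fin (suc n)) → toℕ τ ≢ 0 → interSize A A τ ≤ 1

  diffCount≤1 : (A : SubsetIZ m (suc n)) → AutoCorrelation≤1 A →
                {i j : Fin m} {d : Fin (suc n)} → Nontrivial i j d → diffCount A i j d ≤ 1
  diffCount≤1 A autoCor {i} {j} {d} nontrivial =
    sum≤1 (λ x → 𝟙 (A i x) * 𝟙 (A j (x ⊕ toℕ d))) (λ x → 𝟙*𝟙≤1 (A i x) _) twice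
    where
    twice : ∀ {x y} → x ≢ y → 0 < 𝟙 (A i x) * 𝟙 (A j (x ⊕ toℕ d)) → 0 < 𝟙 (A i y) * 𝟙 (A j (y ⊕ toℕ d)) → ⊥
    twice {x} {y} x≢y 0<x 0<y with 𝟙*𝟙-positive (A i x) _ 0<x | 𝟙*𝟙-positive (A i y) _ 0<y
    ... | Ax , Ax+d | Ay , Ay+d =
      1+n≰n (≤-trans (sharedDifference A A nontrivial Ax Ax+d Ay Ay+d) (autoCor (x ⊖ y) (⊖≢0 x≢y)))

  diffCount-disjoint : (A B : SubsetIZ m (suc n)) → (∀ τ → interSize A B τ ≤ 1) →
                       {i j : Fin m} {d : Fin (suc n)} → Nontrivial i j d →
                       0 < diffCount A i j d → 0 < diffCount B i j d → ⊥
  diffCount-disjoint A B crossCor nontrivial 0<A 0<B with diffCount-positive A 0<A | diffCount-positive B 0<B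
  ... | x , Ax , Ax+d | y , By , By+d =
    1+n≰n (≤-trans (sharedDifference A B nontrivial Ax Ax+d By By+d) (crossCor (x ⊖ y)))

  diffCount-involution≡0 : (A : SubsetIZ m (suc n)) → AutoCorrelation≤1 A →
                           (d : Fin (suc n)) → toℕ d ≢ 0 → (∀ x → (x ⊕ toℕ d) ⊕ toℕ d ≡ x) →
                           (i : Fin m) → diffCount A i i d ≡ 0
  diffCount-involution≡0 A autoCor d d≢0 involutive i = n≤0⇒n≡0 (≮⇒≥ impossible)
    where
    impossible : ¬ (0 < diffCount A i i d)
    impossible 0<count with diffCount-positive A 0<count
    ... | x , Ax , Ax+d = 1+n≰n (≤-trans two (autoCor d d≢0))
      where
      two : 2 ≤ interSize A A d
      two = interSize≥2 A A d (λ eq → d≢0 (⊕-fixed⇒0 x d (sym (cong proj₂ eq))))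
                        Ax Ax+d Ax+d (trans (cong (A i) (involutive x)) Ax)

  ∑diffCount-weighted : (A : SubsetIZ m (suc n)) (i j : Fin m) (w : Fin (suc n) → ℕ)
                        (g : Fin (suc n) → Fin (suc n) → ℕ) → (∀ x d → w d ≡ g x (x ⊕ toℕ d)) →
                        ∑[ d < suc n ] (diffCount A i j d * w d) ≡
                        ∑[ x < suc n ] ∑[ y < suc n ] (𝟙 (A i x) * 𝟙 (A j y) * g x y)
  ∑diffCount-weighted A i j w g w≡g = begin
    ∑[ d < suc n ] (diffCount A i j d * w d)
      ≡⟨ sum-cong-≗ (λ d → *-distribʳ-sum (w d) (λ x → 𝟙 (A i x) * 𝟙 (A j (x ⊕ toℕ d)))) ⟩
    ∑[ d < suc n ] ∑[ x < suc n ] (𝟙 (A i x) * 𝟙 (A j (x ⊕ toℕ d)) * w d)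
      ≡⟨ ∑-comm (λ d x → 𝟙 (A i x) * 𝟙 (A j (x ⊕ toℕ d)) * w d) ⟩
    ∑[ x < suc n ] ∑[ d < suc n ] (𝟙 (A i x) * 𝟙 (A j (x ⊕ toℕ d)) * w d)
      ≡⟨ sum-cong-≗ (λ x → sum-cong-≗ (λ d → cong₂ (λ y v → 𝟙 (A i x) * 𝟙 (A j y) * v)
                                                   (⊕-toℕ-comm x d)
                                                   (trans (w≡g x d) (cong (g x) (⊕-toℕ-comm x d))))) ⟩
    ∑[ x < suc n ] ∑[ d < suc n ] (𝟙 (A i x) * 𝟙 (A j (d ⊕ toℕ x)) * g x (d ⊕ toℕ x))
      ≡⟨ sum-cong-≗ (λ x → sum-shift (toℕ x) (λ y → 𝟙 (A i x) * 𝟙 (A j y) * g x y)) ⟩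
    ∑[ x < suc n ] ∑[ y < suc n ] (𝟙 (A i x) * 𝟙 (A j y) * g x y)
      ∎

  ∑diffCount : (A : SubsetIZ m (suc n)) (i j : Fin m) →
               ∑[ d < suc n ] diffCount A i j d ≡ rowSize A i * rowSize A j
  ∑diffCount A i j = begin
    ∑[ d < suc n ] diffCount A i j d
      ≡⟨ sum-cong-≗ (λ d → *-identityʳ (diffCount A i j d)) ⟨
    ∑[ d < suc n ] (diffCount A i j d * 1)
      ≡⟨ ∑diffCount-weighted A i j (λ _ → 1) (λ _ _ → 1) (λ _ _ → refl) ⟩
    ∑[ x < suc n ] ∑[ y < suc n ] (𝟙 (A i x) * 𝟙 (A j y) * 1)
      ≡⟨ sum-cong-≗ (λ x → sum-cong-≗ (λ y → *-identityʳ (𝟙 (A i x) * 𝟙 (A j y)))) ⟩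
    ∑[ x < suc n ] ∑[ y < suc n ] (𝟙 (A i x) * 𝟙 (A j y))
      ≡⟨ sum-product (𝟙 ∘ A i) (𝟙 ∘ A j) ⟩
    rowSize A i * rowSize A j
      ∎

  diffCount-zero : (A : SubsetIZ m (suc n)) (i : Fin m) → diffCount A i i fzero ≡ rowSize A i
  diffCount-zero A i =
    sum-cong-≗ (λ x → trans (cong (λ y → 𝟙 (A i x) * 𝟙 (A i y)) (⊕-identityʳ x)) (𝟙-idem (A i x)))

  diffCount-neg : (A : SubsetIZ m (suc n)) (i j : Fin m) (d : Fin (suc n)) →
                  diffCount A j i (- d) ≡ diffCount A i j d
  diffCount-neg A i j d = begin
    ∑[ y < suc n ] (𝟙 (A j y) * 𝟙 (A i (y ⊕ toℕ (- d))))
      ≡⟨ sum-shift (toℕ d) (λ y → 𝟙 (A j y) * 𝟙 (A i (y ⊕ toℕ (- d)))) ⟨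
    ∑[ x < suc n ] (𝟙 (A j (x ⊕ toℕ d)) * 𝟙 (A i ((x ⊕ toℕ d) ⊕ toℕ (- d))))
      ≡⟨ sum-cong-≗ (λ x → cong (λ y → 𝟙 (A j (x ⊕ toℕ d)) * 𝟙 (A i y)) (⊕-negʳ x d)) ⟩
    ∑[ x < suc n ] (𝟙 (A j (x ⊕ toℕ d)) * 𝟙 (A i x))
      ≡⟨ sum-cong-≗ (λ x → *-comm (𝟙 (A j (x ⊕ toℕ d))) (𝟙 (A i x))) ⟩
    diffCount A i j d
      ∎

  oddPoints evenPoints : SubsetIZ m (suc n) → Fin m → ℕ
  oddPoints  A i = ∑[ x < suc n ] (𝟙 (A i x) * odd x)
  evenPoints A i = ∑[ x < suc n ] (𝟙 (A i x) * even x)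

  oddPoints+evenPoints : (A : SubsetIZ m (suc n)) (i : Fin m) → oddPoints A i + evenPoints A i ≡ rowSize A i
  oddPoints+evenPoints A i = trans (sym (∑-distrib-+ (λ x → 𝟙 (A i x) * odd x) (λ x → 𝟙 (A i x) * even x)))
                                   (sum-cong-≗ split)
    where
    split : ∀ x → 𝟙 (A i x) * odd x + 𝟙 (A i x) * even x ≡ 𝟙 (A i x)
    split x = trans (sym (*-distribˡ-+ (𝟙 (A i x)) (odd x) (even x)))
                    (trans (cong (𝟙 (A i x) *_) (odd+even≡1 x)) (*-identityʳ (𝟙 (A i x))))

  ∑diffCount-odd : (A : SubsetIZ m (suc n)) → 2 ∣ suc n → (i j : Fin m) →
                   ∑[ d < suc n ] (diffCount A i j d * odd d) ≡
                   oddPoints A i * evenPoints A j + evenPoints A i * oddPoints A j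
  ∑diffCount-odd A 2∣n i j = begin
    ∑[ d < suc n ] (diffCount A i j d * odd d)
      ≡⟨ ∑diffCount-weighted A i j odd (λ x y → odd x * even y + even x * odd y) (odd-difference 2∣n) ⟩
    ∑[ x < suc n ] ∑[ y < suc n ] (a i x * a j y * (odd x * even y + even x * odd y))
      ≡⟨ sum-cong-≗ (λ x → sum-cong-≗ (λ y → expand (a i x) (a j y) (odd x) (even y) (even x) (odd y))) ⟩
    ∑[ x < suc n ] ∑[ y < suc n ] (a i x * odd x * (a j y * even y) + a i x * even x * (a j y * odd y))
      ≡⟨ sum²-distrib-+ (λ x y → a i x * odd x * (a j y * even y)) (λ x y → a i x * even x * (a j y * odd y)) ⟩
    ∑[ x < suc n ] ∑[ y < suc n ] (a i x * odd x * (a j y * even y)) +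
    ∑[ x < suc n ] ∑[ y < suc n ] (a i x * even x * (a j y * odd y))
      ≡⟨ cong₂ _+_ (sum-product (λ x → a i x * odd x) (λ y → a j y * even y))
                   (sum-product (λ x → a i x * even x) (λ y → a j y * odd y)) ⟩
    oddPoints A i * evenPoints A j + evenPoints A i * oddPoints A j
      ∎
    where
    a : Fin m → Fin (suc n) → ℕ
    a i x = 𝟙 (A i x)
    expand : ∀ u v p q r s → u * v * (p * q + r * s) ≡ u * p * (v * q) + u * r * (v * s)
    expand = solve-∀

module _ {m n : ℕ} (A : SubsetIZ m (suc n)) (card≡3 : card A ≡ 3) where

  private
    ∑rowSize≡3 : ∑[ i < m ] rowSize A i ≡ 3
    ∑rowSize≡3 = trans (sym (card≡∑rowSize A)) card≡3

  ∑³diffCount≡9 : ∑³ (diffCount A) ≡ 9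
  ∑³diffCount≡9 = begin
    ∑³ (diffCount A)                                 ≡⟨ sum-cong-≗ (λ i → sum-cong-≗ (∑diffCount A i)) ⟩
    ∑[ i < m ] ∑[ j < m ] (rowSize A i * rowSize A j) ≡⟨ sum-product (rowSize A) (rowSize A) ⟩
    ∑[ i < m ] rowSize A i * ∑[ i < m ] rowSize A i   ≡⟨ cong (λ r → r * r) ∑rowSize≡3 ⟩
    9                                                ∎

  offRowDifferences-even : ∀ i → 2 ∣ ∑[ j < m ] (distinct i j * ∑[ d < suc n ] diffCount A i j d)
  offRowDifferences-even i = subst (2 ∣_) (sym offRow≡) (2∣product-of-split-3 (rowSize A i) _ split)
    where
    others : ℕ
    others = ∑[ j < m ] (distinct i j * rowSize A j)
    split : rowSize A i + others ≡ 3
    split = trans (sym (sum-split-at i (rowSize A))) ∑rowSize≡3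
    offRow≡ : ∑[ j < m ] (distinct i j * ∑[ d < suc n ] diffCount A i j d) ≡ rowSize A i * others
    offRow≡ = begin
      ∑[ j < m ] (distinct i j * ∑[ d < suc n ] diffCount A i j d)
        ≡⟨ sum-cong-≗ (λ j → cong (distinct i j *_) (∑diffCount A i j)) ⟩
      ∑[ j < m ] (distinct i j * (rowSize A i * rowSize A j))
        ≡⟨ sum-cong-≗ (λ j → rearrange (distinct i j) (rowSize A i) (rowSize A j)) ⟩
      ∑[ j < m ] (rowSize A i * (distinct i j * rowSize A j))
        ≡⟨ *-distribˡ-sum (rowSize A i) (λ j → distinct i j * rowSize A j) ⟨
      rowSize A i * others
        ∎
      where
      rearrange : ∀ u v w → u * (v * w) ≡ v * (u * w)
      rearrange = solve-∀

  oddDifferences : 2 ∣ suc n → 4 ∣ ∑³ (λ i j d → diffCount A i j d * odd d)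
  oddDifferences 2∣n =
    subst (4 ∣_) (sym odd≡) (2∣ab⇒4∣ab+ba {Odd} {Even} (2∣product-of-split-3 Odd Even Odd+Even≡3))
    where
    Odd Even : ℕ
    Odd  = ∑[ i < m ] oddPoints A i
    Even = ∑[ i < m ] evenPoints A i

    Odd+Even≡3 : Odd + Even ≡ 3
    Odd+Even≡3 = begin
      Odd + Even                                    ≡⟨ ∑-distrib-+ (oddPoints A) (evenPoints A) ⟨
      ∑[ i < m ] (oddPoints A i + evenPoints A i)   ≡⟨ sum-cong-≗ (oddPoints+evenPoints A) ⟩
      ∑[ i < m ] rowSize A i                        ≡⟨ ∑rowSize≡3 ⟩
      3                                             ∎

    odd≡ : ∑³ (λ i j d → diffCount A i j d * odd d) ≡ Odd * Even + Even * Odd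
    odd≡ = begin
      ∑³ (λ i j d → diffCount A i j d * odd d)
        ≡⟨ sum-cong-≗ (λ i → sum-cong-≗ (∑diffCount-odd A 2∣n i)) ⟩
      ∑[ i < m ] ∑[ j < m ] (oddPoints A i * evenPoints A j + evenPoints A i * oddPoints A j)
        ≡⟨ sum²-distrib-+ (λ i j → oddPoints A i * evenPoints A j) (λ i j → evenPoints A i * oddPoints A j) ⟩
      ∑[ i < m ] ∑[ j < m ] (oddPoints A i * evenPoints A j) + ∑[ i < m ] ∑[ j < m ] (evenPoints A i * oddPoints A j)
        ≡⟨ cong₂ _+_ (sum-product (oddPoints A) (evenPoints A)) (sum-product (evenPoints A) (oddPoints A)) ⟩
      Odd * Even + Even * Odd
        ∎

-- Symmetric difference patterns

module _ {m k : ℕ} (F : Fin m → Fin m → Fin k → ℕ) where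

  outDegree : Fin m → ℕ
  outDegree i = ∑[ j < m ] (distinct i j * ∑[ d < k ] F i j d)

  loops : ℕ
  loops = ∑[ i < m ] ∑[ d < k ] F i i d

  ∑³≡outDegrees+loops : ∑³ F ≡ ∑[ i < m ] outDegree i + loops
  ∑³≡outDegrees+loops = trans (sum-cong-≗ split) (∑-distrib-+ outDegree (λ i → ∑[ d < k ] F i i d))
    where
    split : ∀ i → ∑[ j < m ] ∑[ d < k ] F i j d ≡ outDegree i + ∑[ d < k ] F i i d
    split i = trans (sum-split-at i (λ j → ∑[ d < k ] F i j d)) (+-comm _ (outDegree i))

  outDegree-positive⇒edge : ∀ i → 0 < outDegree i → ∃₂ λ j d → i ≢ j × 0 < F i j d
  outDegree-positive⇒edge i 0<out with sum-positive (λ j → distinct i j * ∑[ d < k ] F i j d) 0<out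
  ... | j , 0<term with *-positive (distinct i j) _ 0<term
  ...   | 0<δ , 0<∑ with sum-positive (F i j) 0<∑
  ...     | d , 0<F = j , d , distinct-positive 0<δ , 0<F

  edge⇒outDegree-positive : ∀ {i j d} → i ≢ j → 0 < F i j d → 0 < outDegree i
  edge⇒outDegree-positive {i} {j} {d} i≢j 0<F =
    ≤-trans 0<F (≤-trans (term≤sum (F i j) d)
                         (subst (_≤ outDegree i) weight≡1 (term≤sum (λ j → distinct i j * ∑[ d < k ] F i j d) j)))
    where
    weight≡1 : distinct i j * ∑[ d < k ] F i j d ≡ ∑[ d < k ] F i j d
    weight≡1 = trans (cong (_* ∑[ d < k ] F i j d) (distinct-≢ i≢j)) (*-identityˡ _)

outDegree-cong : ∀ {m k} (F G : Fin m → Fin m → Fin k → ℕ) i → (∀ j d → F i j d ≡ G i j d) →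
                 outDegree F i ≡ outDegree G i
outDegree-cong F G i F≡G = sum-cong-≗ (λ j → cong (distinct i j *_) (sum-cong-≗ (F≡G j)))

outDegree-+ : ∀ {m k} (F G : Fin m → Fin m → Fin k → ℕ) i →
              outDegree (λ i j d → F i j d + G i j d) i ≡ outDegree F i + outDegree G i
outDegree-+ {m} {k} F G i = begin
  ∑[ j < m ] (distinct i j * ∑[ d < k ] (F i j d + G i j d))
    ≡⟨ sum-cong-≗ (λ j → trans (cong (distinct i j *_) (∑-distrib-+ (F i j) (G i j)))
                               (*-distribˡ-+ (distinct i j) (sum (F i j)) (sum (G i j)))) ⟩
  ∑[ j < m ] (distinct i j * ∑[ d < k ] F i j d + distinct i j * ∑[ d < k ] G i j d)
    ≡⟨ ∑-distrib-+ (λ j → distinct i j * ∑[ d < k ] F i j d) (λ j → distinct i j * ∑[ d < k ] G i j d) ⟩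
  outDegree F i + outDegree G i
    ∎

module _ {m n : ℕ} (L : Fin m → Fin m → Fin (suc n) → ℕ)
         (symmetric : ∀ {i j d} → i ≢ j → 0 < L i j d → 0 < L j i (- d))
         (outDegree-even : ∀ i → 2 ∣ outDegree L i) where

  edge⇒outDegrees≥2 : ∀ {i j d} → i ≢ j → 0 < L i j d → 2 ≤ outDegree L i × 2 ≤ outDegree L j
  edge⇒outDegrees≥2 {i} {j} i≢j 0<L =
      even-positive⇒≥2 (outDegree-even i) (edge⇒outDegree-positive L i≢j 0<L)
    , even-positive⇒≥2 (outDegree-even j) (edge⇒outDegree-positive L (i≢j ∘ sym) (symmetric i≢j 0<L))

  ∑outDegree≥4 : 0 < ∑[ i < m ] outDegree L i → 4 ≤ ∑[ i < m ] outDegree L i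
  ∑outDegree≥4 0<∑ with sum-positive (outDegree L) 0<∑
  ... | i , 0<out with outDegree-positive⇒edge L i 0<out
  ...   | j , d , i≢j , 0<L with edge⇒outDegrees≥2 i≢j 0<L
  ...     | 2≤outᵢ , 2≤outⱼ = ≤-trans (+-mono-≤ 2≤outᵢ 2≤outⱼ) (two-terms≤sum (outDegree L) i≢j)

  -- An entry off the diagonal would force ∑ outDegree ≥ 4, so both entries are loops.
  odd-loops : (∀ i d → 0 < L i i d → odd d ≡ 1) → ∑³ L ≡ 2 → ∑³ (λ i j d → L i j d * odd d) ≡ 2
  odd-loops loops-odd ∑L≡2 = ≤-antisym upper lower
    where
    Out≡0 : ∑[ i < m ] outDegree L i ≡ 0
    ∑L≡Out+loops : ∑³ L ≡ ∑[ i < m ] outDegree L i + loops L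
    ∑L≡Out+loops = ∑³≡outDegrees+loops L
    Out≡0 = n≤0⇒n≡0 (≮⇒≥ λ 0<Out → 4≰2 (≤-trans (∑outDegree≥4 0<Out)
                                         (≤-trans (m≤m+n _ (loops L)) (≤-reflexive (trans (sym ∑L≡Out+loops) ∑L≡2)))))
      where
      4≰2 : ¬ (4 ≤ 2)
      4≰2 (s≤s (s≤s ()))
    loop-odd : ∀ i d → L i i d * odd d ≡ L i i d
    loop-odd i d with L i i d in eq
    ... | zero  = refl
    ... | suc c = trans (cong (suc c *_) (loops-odd i d (subst (0 <_) (sym eq) (s≤s z≤n)))) (*-identityʳ _)
    upper : ∑³ (λ i j d → L i j d * odd d) ≤ 2
    upper = ≤-trans (∑³-mono-≤ (λ i j d → *odd≤ (L i j d) d)) (≤-reflexive ∑L≡2)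
    lower : 2 ≤ ∑³ (λ i j d → L i j d * odd d)
    lower = ≤-trans (≤-reflexive 2≡loops)
                    (≤-trans (m≤n+m _ _) (≤-reflexive (sym (∑³≡outDegrees+loops (λ i j d → L i j d * odd d)))))
      where
      2≡loops : 2 ≡ loops (λ i j d → L i j d * odd d)
      2≡loops = begin
        2                                  ≡⟨ trans (sym ∑L≡2) (trans ∑L≡Out+loops (cong (_+ loops L) Out≡0)) ⟩
        loops L                            ≡⟨ sum-cong-≗ (λ i → sum-cong-≗ (loop-odd i)) ⟨
        loops (λ i j d → L i j d * odd d)  ∎

module _ {m : ℕ} (L : Fin m → Fin m → Fin 2 → ℕ) (L≤1 : ∀ i j d → L i j d ≤ 1)
         (symmetric : ∀ {i j d} → i ≢ j → 0 < L i j d → 0 < L j i (- d))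
         (outDegree-even : ∀ i → 2 ∣ outDegree L i) (no-loops : ∀ i d → L i i d ≡ 0)
         (∑L≡4 : ∑³ L ≡ 4) where

  private
    Out≡4 : ∑[ i < m ] outDegree L i ≡ 4
    Out≡4 = begin
      ∑[ i < m ] outDegree L i            ≡⟨ +-identityʳ _ ⟨
      ∑[ i < m ] outDegree L i + 0        ≡⟨ cong (∑[ i < m ] outDegree L i +_) (sum-zero _ (λ i → sum-zero _ (no-loops i))) ⟨
      ∑[ i < m ] outDegree L i + loops L  ≡⟨ ∑³≡outDegrees+loops L ⟨
      ∑³ L                                ≡⟨ ∑L≡4 ⟩
      4                                   ∎

    -- A second neighbour l of i would give three rows of out-degree ≥ 2.
    edge⇒both-differences : ∀ {i j d} → i ≢ j → 0 < L i j d → 0 < L i j fzero × 0 < L i j (fsuc fzero)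
    edge⇒both-differences {i} {j} i≢j 0<L = both-positive (L≤1 i j fzero) (L≤1 i j (fsuc fzero))
                                                         (subst (2 ≤_) (cong (L i j fzero +_) (+-identityʳ _)) 2≤Sⱼ)
      where
      S : Fin m → ℕ
      S l = ∑[ d < 2 ] L i l d
      2≤outᵢ = proj₁ (edge⇒outDegrees≥2 L symmetric outDegree-even i≢j 0<L)
      2≤outⱼ = proj₂ (edge⇒outDegrees≥2 L symmetric outDegree-even i≢j 0<L)
      others≡0 : ∑[ l < m ] (distinct j l * (distinct i l * S l)) ≡ 0
      others≡0 = n≤0⇒n≡0 (≮⇒≥ third-neighbour)
        where
        third-neighbour : ¬ (0 < ∑[ l < m ] (distinct j l * (distinct i l * S l)))
        third-neighbour 0<∑ with sum-positive (λ l → distinct j l * (distinct i l * S l)) 0<∑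
        ... | l , 0<term with *-positive (distinct j l) _ 0<term
        ...   | 0<δⱼ , 0<rest with *-positive (distinct i l) _ 0<rest
        ...     | 0<δᵢ , 0<S with sum-positive (L i l) 0<S
        ...       | d′ , 0<L′ =
          6≰4 (≤-trans (+-mono-≤ (+-mono-≤ 2≤outᵢ 2≤outⱼ) (proj₂ (edge⇒outDegrees≥2 L symmetric outDegree-even i≢l 0<L′)))
                       (≤-trans (three-terms≤sum (outDegree L) i≢j i≢l (distinct-positive 0<δⱼ)) (≤-reflexive Out≡4)))
          where
          i≢l = distinct-positive 0<δᵢ
          6≰4 : ¬ (6 ≤ 4)
          6≰4 (s≤s (s≤s (s≤s (s≤s ()))))
      2≤Sⱼ : 2 ≤ S j
      2≤Sⱼ = ≤-trans 2≤outᵢ (≤-reflexive (begin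
        outDegree L i                                               ≡⟨ sum-split-at j (λ l → distinct i l * S l) ⟩
        distinct i j * S j + ∑[ l < m ] (distinct j l * (distinct i l * S l))
                                                                    ≡⟨ cong₂ _+_ (cong (_* S j) (distinct-≢ i≢j)) others≡0 ⟩
        1 * S j + 0                                                 ≡⟨ trans (+-identityʳ _) (*-identityˡ (S j)) ⟩
        S j                                                         ∎))

  -- The four entries are (i, j, d) and (j, i, d) for d = 0, 1 and a single pair i ≢ j.
  odd-pairs : ∑³ (λ i j d → L i j d * odd d) ≡ 2
  odd-pairs with sum-positive (outDegree L) (subst (0 <_) (sym Out≡4) (s≤s z≤n))
  ... | i , 0<out with outDegree-positive⇒edge L i 0<out
  ...   | j , d , i≢j , 0<L with edge⇒both-differences i≢j 0<L
  ...     | 0<L₀ , 0<L₁ = trans (sum-cong-≗ (λ a → sum-cong-≗ (odd-part a))) (≤-antisym O≤2 2≤O)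
    where
    E O : ℕ
    E = ∑[ a < m ] ∑[ b < m ] L a b fzero
    O = ∑[ a < m ] ∑[ b < m ] L a b (fsuc fzero)
    odd-part : ∀ a b → ∑[ d < 2 ] (L a b d * odd d) ≡ L a b (fsuc fzero)
    odd-part a b = trans (cong₂ _+_ (*-zeroʳ (L a b fzero)) (+-identityʳ _)) (*-identityʳ _)
    E+O≡4 : E + O ≡ 4
    E+O≡4 = trans (sym (sum²-distrib-+ (λ a b → L a b fzero) (λ a b → L a b (fsuc fzero))))
                  (trans (sum-cong-≗ (λ a → sum-cong-≗ (λ b → cong (L a b fzero +_) (sym (+-identityʳ _))))) ∑L≡4)
    2≤E : 2 ≤ E
    2≤E = ≤-trans (+-mono-≤ 0<L₀ (symmetric i≢j 0<L₀)) (two-entries≤sum² (λ a b → L a b fzero) i≢j)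
    2≤O : 2 ≤ O
    2≤O = ≤-trans (+-mono-≤ 0<L₁ (symmetric i≢j 0<L₁)) (two-entries≤sum² (λ a b → L a b (fsuc fzero)) i≢j)
    O≤2 : O ≤ 2
    O≤2 = +-cancelˡ-≤ 2 O 2 (≤-trans (+-monoˡ-≤ O 2≤E) (≤-reflexive E+O≡4))

-- Double counting over a code

module Counting {m n N : ℕ} (C : Fin N → SubsetIZ m (suc n)) (ooc : IsOOC m (suc n) 3 N C)
                (h : ℕ) (n≡h+h : suc n ≡ h + h) where

  open IsOOC ooc

  0<h : 0 < h
  0<h = n≢0⇒n>0 (λ h≡0 → 0≢1+n (sym (trans n≡h+h (cong (λ a → a + a) h≡0))))

  2∣n : 2 ∣ suc n
  2∣n = divides h (trans n≡h+h (a+a≡a*2 h))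

  half : Fin (suc n)
  half = fromℕ< (subst (h <_) (sym n≡h+h) (m<m+n h 0<h))

  toℕ-half : toℕ half ≡ h
  toℕ-half = toℕ-fromℕ< _

  half≢0 : toℕ half ≢ 0
  half≢0 eq = <-irrefl (sym (trans (sym toℕ-half) eq)) 0<h

  half-involutive : ∀ x → (x ⊕ toℕ half) ⊕ toℕ half ≡ x
  half-involutive x = subst (λ c → (x ⊕ c) ⊕ c ≡ x) (sym toℕ-half) (⊕-half-involutive h n≡h+h x)

  private
    weight : Fin (suc n) → ℕ
    weight d = same fzero d + same half d

  -- Besides d = 0, the difference n/2 is excluded on the diagonal: no codeword has it.
  trivial nontrivial : Fin m → Fin m → Fin (suc n) → ℕ
  trivial    i j d = same i j * weight d
  nontrivial i j d = 1 ∸ trivial i j d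

  private
    weight-zero : 1 ≤ weight fzero
    weight-zero = subst (λ s → 1 ≤ s + same half fzero) (sym (same-refl {suc n} fzero)) (s≤s z≤n)

    weight-half : 1 ≤ weight half
    weight-half = subst (λ s → 1 ≤ same fzero half + s) (sym (same-refl half)) (m≤n+m 1 (same fzero half))

    weight≤1 : ∀ d → weight d ≤ 1
    weight≤1 d with fzero ≟ᶠ d
    ... | yes refl = ≤-reflexive (cong (1 +_) (same-≢ (half≢0 ∘ cong toℕ)))
    ... | no _     = same≤1 half d

    loop-trivial : ∀ i d → 1 ≤ weight d → nontrivial i i d ≡ 0
    loop-trivial i d 1≤w =
      m≤n⇒m∸n≡0 (subst (1 ≤_) (sym (trans (cong (_* weight d) (same-refl i)) (*-identityˡ (weight d)))) 1≤w)

  trivial≤1 : ∀ i j d → trivial i j d ≤ 1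
  trivial≤1 i j d = *-mono-≤ (same≤1 i j) (weight≤1 d)

  nontrivial≤1 : ∀ i j d → nontrivial i j d ≤ 1
  nontrivial≤1 i j d = m∸n≤m 1 (trivial i j d)

  nontrivial-≢ : ∀ {i j} d → i ≢ j → nontrivial i j d ≡ 1
  nontrivial-≢ {i} {j} d i≢j = cong (λ s → 1 ∸ s * weight d) (same-≢ i≢j)

  nontrivial-zero : ∀ i → nontrivial i i fzero ≡ 0
  nontrivial-zero i = loop-trivial i fzero weight-zero

  nontrivial-half : ∀ i → nontrivial i i half ≡ 0
  nontrivial-half i = loop-trivial i half weight-half

  nontrivial-cases : ∀ i j d → nontrivial i j d ≡ 0 ⊎ (nontrivial i j d ≡ 1 × Nontrivial i j d)
  nontrivial-cases i j d with nontrivial i j d in eq | nontrivial≤1 i j d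
  ... | zero  | _       = inj₁ refl
  ... | suc _ | s≤s z≤n = inj₂ (refl , trivial-position)
    where
    trivial-position : Nontrivial i j d
    trivial-position (refl , d≡0) with toℕ-injective {j = fzero} d≡0
    ... | refl = 0≢1+n (trans (sym (nontrivial-zero i)) eq)

  ∑³-split-trivial : (D : Fin m → Fin m → Fin (suc n) → ℕ) →
                     ∑³ D ≡ ∑³ (λ i j d → nontrivial i j d * D i j d) +
                            (∑[ i < m ] D i i fzero + ∑[ i < m ] D i i half)
  ∑³-split-trivial D = begin
    ∑³ D
      ≡⟨ ∑³-cong split ⟩
    ∑³ (λ i j d → nontrivial i j d * D i j d + trivial i j d * D i j d)
      ≡⟨ ∑³-distrib-+ (λ i j d → nontrivial i j d * D i j d) (λ i j d → trivial i j d * D i j d) ⟩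
    ∑³ (λ i j d → nontrivial i j d * D i j d) + ∑³ (λ i j d → trivial i j d * D i j d)
      ≡⟨ cong (∑³ (λ i j d → nontrivial i j d * D i j d) +_) trivial-part ⟩
    ∑³ (λ i j d → nontrivial i j d * D i j d) + (∑[ i < m ] D i i fzero + ∑[ i < m ] D i i half)
      ∎
    where
    split : ∀ i j d → D i j d ≡ nontrivial i j d * D i j d + trivial i j d * D i j d
    split i j d = sym (trans (sym (*-distribʳ-+ (D i j d) (nontrivial i j d) (trivial i j d)))
                             (trans (cong (_* D i j d) (m∸n+n≡m (trivial≤1 i j d))) (*-identityˡ (D i j d))))
    row : ∀ i → ∑[ d < suc n ] (weight d * D i i d) ≡ D i i fzero + D i i half
    row i = trans (sum-cong-≗ (λ d → *-distribʳ-+ (D i i d) (same fzero d) (same half d)))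
                  (trans (∑-distrib-+ (λ d → same fzero d * D i i d) (λ d → same half d * D i i d))
                         (cong₂ _+_ (sum-same fzero (D i i)) (sum-same half (D i i))))
    trivial-part : ∑³ (λ i j d → trivial i j d * D i j d) ≡ ∑[ i < m ] D i i fzero + ∑[ i < m ] D i i half
    trivial-part = begin
      ∑[ i < m ] ∑[ j < m ] ∑[ d < suc n ] (same i j * weight d * D i j d)
        ≡⟨ sum-cong-≗ (λ i → sum-cong-≗ (λ j → trans (sum-cong-≗ (λ d → *-assoc (same i j) (weight d) (D i j d)))
                                                      (sym (*-distribˡ-sum (same i j) (λ d → weight d * D i j d))))) ⟩
      ∑[ i < m ] ∑[ j < m ] (same i j * ∑[ d < suc n ] (weight d * D i j d))
        ≡⟨ sum-cong-≗ (λ i → trans (sum-same i (λ j → ∑[ d < suc n ] (weight d * D i j d))) (row i)) ⟩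
      ∑[ i < m ] (D i i fzero + D i i half)
        ≡⟨ ∑-distrib-+ (λ i → D i i fzero) (λ i → D i i half) ⟩
      ∑[ i < m ] D i i fzero + ∑[ i < m ] D i i half
        ∎

  nontrivialDiffCount : Fin N → Fin m → Fin m → Fin (suc n) → ℕ
  nontrivialDiffCount a i j d = nontrivial i j d * diffCount (C a) i j d

  covered uncovered : Fin m → Fin m → Fin (suc n) → ℕ
  covered   i j d = ∑[ a < N ] nontrivialDiffCount a i j d
  uncovered i j d = nontrivial i j d ∸ covered i j d

  diffCount-half : ∀ a i → diffCount (C a) i i half ≡ 0
  diffCount-half a = diffCount-involution≡0 (C a) (autoCor a) half half≢0 half-involutive

  covered≤nontrivial : ∀ i j d → covered i j d ≤ nontrivial i j d
  covered≤nontrivial i j d with nontrivial-cases i j d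
  ... | inj₁ eq = ≤-reflexive (trans (sum-zero _ (λ a → cong (_* diffCount (C a) i j d) eq)) (sym eq))
  ... | inj₂ (eq , nontriv) = subst₂ _≤_ (sym covered≡∑) (sym eq)
    (sum≤1 (λ a → diffCount (C a) i j d) (λ a → diffCount≤1 (C a) (autoCor a) nontriv)
           (λ a≢b → diffCount-disjoint (C _) (C _) (crossCor _ _ a≢b) nontriv))
    where
    covered≡∑ : covered i j d ≡ ∑[ a < N ] diffCount (C a) i j d
    covered≡∑ = sum-cong-≗ (λ a → trans (cong (_* diffCount (C a) i j d) eq) (*-identityˡ _))

  uncovered+covered : ∀ i j d → uncovered i j d + covered i j d ≡ nontrivial i j d
  uncovered+covered i j d = m∸n+n≡m (covered≤nontrivial i j d)

  uncovered≤1 : ∀ i j d → uncovered i j d ≤ 1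
  uncovered≤1 i j d = ≤-trans (m∸n≤m (nontrivial i j d) (covered i j d)) (nontrivial≤1 i j d)

  uncovered-symmetric : ∀ {i j d} → i ≢ j → 0 < uncovered i j d → 0 < uncovered j i (- d)
  uncovered-symmetric {i} {j} {d} i≢j = subst (0 <_) (sym (cong₂ _∸_ nontrivial≡ (sum-cong-≗ covered≡)))
    where
    nontrivial≡ : nontrivial j i (- d) ≡ nontrivial i j d
    nontrivial≡ = trans (nontrivial-≢ (- d) (i≢j ∘ sym)) (sym (nontrivial-≢ d i≢j))
    covered≡ : ∀ a → nontrivialDiffCount a j i (- d) ≡ nontrivialDiffCount a i j d
    covered≡ a = cong₂ _*_ nontrivial≡ (diffCount-neg (C a) i j d)

  uncovered-loop-zero : ∀ i → uncovered i i fzero ≡ 0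
  uncovered-loop-zero i = trans (cong (_∸ covered i i fzero) (nontrivial-zero i)) (0∸n≡0 (covered i i fzero))

  uncovered-loop-half : ∀ i → uncovered i i half ≡ 0
  uncovered-loop-half i = trans (cong (_∸ covered i i half) (nontrivial-half i)) (0∸n≡0 (covered i i half))

  ∑nontrivialDiffCount≡6 : ∀ a → ∑³ (nontrivialDiffCount a) ≡ 6
  ∑nontrivialDiffCount≡6 a = +-cancelʳ-≡ 3 (∑³ (nontrivialDiffCount a)) 6 (begin
    ∑³ (nontrivialDiffCount a) + 3
      ≡⟨ cong (∑³ (nontrivialDiffCount a) +_) (cong₂ _+_ zero-part (sum-zero _ (diffCount-half a))) ⟨
    ∑³ (nontrivialDiffCount a) + (∑[ i < m ] diffCount (C a) i i fzero + ∑[ i < m ] diffCount (C a) i i half)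
      ≡⟨ ∑³-split-trivial (diffCount (C a)) ⟨
    ∑³ (diffCount (C a))
      ≡⟨ ∑³diffCount≡9 (C a) (size a) ⟩
    9 ∎)
    where
    zero-part : ∑[ i < m ] diffCount (C a) i i fzero ≡ 3
    zero-part = trans (sum-cong-≗ (diffCount-zero (C a))) (trans (sym (card≡∑rowSize (C a))) (size a))

  uncovered-total : ∑³ uncovered + N * 6 + (m + m) ≡ m * (m * (h + h))
  uncovered-total = begin
    ∑³ uncovered + N * 6 + (m + m)
      ≡⟨ cong₂ (λ c s → ∑³ uncovered + c + s) (sym ∑covered≡6N) (cong₂ _+_ m≡∑1 m≡∑1) ⟩
    ∑³ uncovered + ∑³ covered + (∑[ i < m ] 1 + ∑[ i < m ] 1)
      ≡⟨ cong (_+ (∑[ i < m ] 1 + ∑[ i < m ] 1)) (trans (sym (∑³-distrib-+ uncovered covered)) (∑³-cong nontrivial*1)) ⟩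
    ∑³ (λ i j d → nontrivial i j d * 1) + (∑[ i < m ] 1 + ∑[ i < m ] 1)
      ≡⟨ ∑³-split-trivial (λ _ _ _ → 1) ⟨
    ∑³ {m} {suc n} (λ _ _ _ → 1)
      ≡⟨ ∑³-row m {suc n} (λ _ → 1) ⟩
    m * (m * ∑[ d < suc n ] 1)
      ≡⟨ cong (λ k → m * (m * k)) (trans (sum-const (suc n) 1) (trans (*-identityʳ (suc n)) n≡h+h)) ⟩
    m * (m * (h + h))
      ∎
    where
    m≡∑1 : m ≡ ∑[ i < m ] 1
    m≡∑1 = sym (trans (sum-const m 1) (*-identityʳ m))
    nontrivial*1 : ∀ i j d → uncovered i j d + covered i j d ≡ nontrivial i j d * 1
    nontrivial*1 i j d = trans (uncovered+covered i j d) (sym (*-identityʳ _))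
    ∑covered≡6N : ∑³ covered ≡ N * 6
    ∑covered≡6N = trans (∑³-sum nontrivialDiffCount) (trans (sum-cong-≗ ∑nontrivialDiffCount≡6) (sum-const N 6))

  4∣covered-odd : 4 ∣ ∑³ (λ i j d → covered i j d * odd d)
  4∣covered-odd =
    subst (4 ∣_) (sym covered-odd≡) (∣-sum (λ a → ∑³ (λ i j d → nontrivialDiffCount a i j d * odd d)) 4∣codeword)
    where
    covered-odd≡ : ∑³ (λ i j d → covered i j d * odd d) ≡
                   ∑[ a < N ] ∑³ (λ i j d → nontrivialDiffCount a i j d * odd d)
    covered-odd≡ = trans (∑³-cong (λ i j d → *-distribʳ-sum (odd d) (λ a → nontrivialDiffCount a i j d)))
                         (∑³-sum (λ a i j d → nontrivialDiffCount a i j d * odd d))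
    trivial-part : ∀ a → ∑[ i < m ] (diffCount (C a) i i fzero * 0) +
                         ∑[ i < m ] (diffCount (C a) i i half * odd half) ≡ 0
    trivial-part a = cong₂ _+_ (sum-zero _ (λ i → *-zeroʳ (diffCount (C a) i i fzero)))
                               (sum-zero _ (λ i → cong (_* odd half) (diffCount-half a i)))
    4∣codeword : ∀ a → 4 ∣ ∑³ (λ i j d → nontrivialDiffCount a i j d * odd d)
    4∣codeword a = subst (4 ∣_) (begin
      ∑³ (λ i j d → diffCount (C a) i j d * odd d)
        ≡⟨ ∑³-split-trivial (λ i j d → diffCount (C a) i j d * odd d) ⟩
      ∑³ (λ i j d → nontrivial i j d * (diffCount (C a) i j d * odd d)) + _
        ≡⟨ cong₂ _+_ (∑³-cong (λ i j d → sym (*-assoc (nontrivial i j d) (diffCount (C a) i j d) (odd d)))) (trivial-part a) ⟩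
      ∑³ (λ i j d → nontrivialDiffCount a i j d * odd d) + 0
        ≡⟨ +-identityʳ _ ⟩
      ∑³ (λ i j d → nontrivialDiffCount a i j d * odd d)
        ∎) (oddDifferences (C a) (size a) 2∣n)

  uncovered-odd-total : ∑³ (λ i j d → uncovered i j d * odd d) + ∑³ (λ i j d → covered i j d * odd d) + m * (h % 2) ≡
                        m * (m * h)
  uncovered-odd-total = begin
    ∑³ (λ i j d → uncovered i j d * odd d) + ∑³ (λ i j d → covered i j d * odd d) + m * (h % 2)
      ≡⟨ cong (_+ m * (h % 2)) (∑³-distrib-+ (λ i j d → uncovered i j d * odd d) (λ i j d → covered i j d * odd d)) ⟨
    ∑³ (λ i j d → uncovered i j d * odd d + covered i j d * odd d) + m * (h % 2)
      ≡⟨ cong₂ _+_ (∑³-cong nontrivial*odd) trivial-odd ⟩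
    ∑³ (λ i j d → nontrivial i j d * odd d) + (∑[ i < m ] odd {suc n} fzero + ∑[ i < m ] odd half)
      ≡⟨ ∑³-split-trivial (λ _ _ d → odd d) ⟨
    ∑³ {m} {suc n} (λ _ _ d → odd d)
      ≡⟨ ∑³-row m (odd {suc n}) ⟩
    m * (m * ∑[ d < suc n ] odd d)
      ≡⟨ cong (λ s → m * (m * s)) (∑odd h n≡h+h) ⟩
    m * (m * h)
      ∎
    where
    nontrivial*odd : ∀ i j d → uncovered i j d * odd d + covered i j d * odd d ≡ nontrivial i j d * odd d
    nontrivial*odd i j d = trans (sym (*-distribʳ-+ (odd d) (uncovered i j d) (covered i j d)))
                                 (cong (_* odd d) (uncovered+covered i j d))
    trivial-odd : m * (h % 2) ≡ ∑[ i < m ] odd {suc n} fzero + ∑[ i < m ] odd half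
    trivial-odd = sym (trans (cong₂ _+_ (sum-zero {m} (λ _ → odd {suc n} fzero) (λ _ → refl)) (sum-const m (odd half)))
                             (cong (λ v → m * (v % 2)) toℕ-half))

  uncovered-odd≤uncovered : ∑³ (λ i j d → uncovered i j d * odd d) ≤ ∑³ uncovered
  uncovered-odd≤uncovered = ∑³-mono-≤ (λ i j d → *odd≤ (uncovered i j d) d)

  outDegree-uncovered-even : ∀ i → 2 ∣ outDegree uncovered i
  outDegree-uncovered-even i = ∣m+n∣m⇒∣n (subst (2 ∣_) out-split out-nontrivial-even) out-covered-even
    where
    out-split : outDegree nontrivial i ≡ outDegree covered i + outDegree uncovered i
    out-split = trans (outDegree-cong nontrivial (λ i j d → covered i j d + uncovered i j d) i
                                      (λ j d → trans (sym (uncovered+covered i j d)) (+-comm (uncovered i j d) (covered i j d))))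
                      (outDegree-+ covered uncovered i)
    out-nontrivial-even : 2 ∣ outDegree nontrivial i
    out-nontrivial-even = ∣-sum (λ j → distinct i j * ∑[ d < suc n ] nontrivial i j d)
                                (λ j → subst (2 ∣_) (sym (distinct-*-cong i row-length {j})) (∣n⇒∣m*n (distinct i j) 2∣n))
      where
      row-length : ∀ j → i ≢ j → ∑[ d < suc n ] nontrivial i j d ≡ suc n
      row-length j i≢j = trans (sum-cong-≗ (λ d → nontrivial-≢ d i≢j)) (trans (sum-const (suc n) 1) (*-identityʳ (suc n)))
    out-covered-even : 2 ∣ outDegree covered i
    out-covered-even = subst (2 ∣_) (sym out-covered≡)
      (∣-sum (λ a → ∑[ j < m ] (distinct i j * ∑[ d < suc n ] diffCount (C a) i j d))
             (λ a → offRowDifferences-even (C a) (size a) i))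
      where
      covered-off-row : ∀ j → i ≢ j →
                        ∑[ d < suc n ] covered i j d ≡ ∑[ a < N ] ∑[ d < suc n ] diffCount (C a) i j d
      covered-off-row j i≢j = trans (∑-comm (λ d a → nontrivialDiffCount a i j d))
        (sum-cong-≗ (λ a → sum-cong-≗ (λ d → trans (cong (_* diffCount (C a) i j d) (nontrivial-≢ d i≢j)) (*-identityˡ _))))
      out-covered≡ : outDegree covered i ≡
                     ∑[ a < N ] ∑[ j < m ] (distinct i j * ∑[ d < suc n ] diffCount (C a) i j d)
      out-covered≡ = begin
        ∑[ j < m ] (distinct i j * ∑[ d < suc n ] covered i j d)
          ≡⟨ sum-cong-≗ (λ j → distinct-*-cong i covered-off-row {j}) ⟩
        ∑[ j < m ] (distinct i j * ∑[ a < N ] ∑[ d < suc n ] diffCount (C a) i j d)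
          ≡⟨ sum-cong-≗ (λ j → *-distribˡ-sum (distinct i j) (λ a → ∑[ d < suc n ] diffCount (C a) i j d)) ⟩
        ∑[ j < m ] ∑[ a < N ] (distinct i j * ∑[ d < suc n ] diffCount (C a) i j d)
          ≡⟨ ∑-comm (λ j a → distinct i j * ∑[ d < suc n ] diffCount (C a) i j d) ⟩
        ∑[ a < N ] ∑[ j < m ] (distinct i j * ∑[ d < suc n ] diffCount (C a) i j d)
          ∎

uncovered-odd-n≡4 : ∀ {m n N} (C : Fin N → SubsetIZ m (suc n)) (ooc : IsOOC m (suc n) 3 N C)
                    h (n≡h+h : suc n ≡ h + h) →
                    suc n ≡ 4 → let open Counting C ooc h n≡h+h in
                    ∑³ uncovered ≡ 2 → ∑³ (λ i j d → uncovered i j d * odd d) ≡ 2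
uncovered-odd-n≡4 C ooc h n≡h+h refl = odd-loops uncovered uncovered-symmetric outDegree-uncovered-even loops-odd
  where
  open Counting C ooc h n≡h+h
  two≡half : fsuc (fsuc fzero) ≡ half
  two≡half = toℕ-injective (sym (trans toℕ-half (double-injective h 2 (sym n≡h+h))))
  loops-odd : ∀ i d → 0 < uncovered i i d → odd d ≡ 1
  loops-odd i fzero                       0<u = ⊥-elim (<-irrefl (sym (uncovered-loop-zero i)) 0<u)
  loops-odd i (fsuc fzero)                _   = refl
  loops-odd i (fsuc (fsuc fzero))         0<u =
    ⊥-elim (<-irrefl (sym (uncovered-loop-half i)) (subst (λ d → 0 < uncovered i i d) two≡half 0<u))
  loops-odd i (fsuc (fsuc (fsuc fzero)))  _   = refl

uncovered-odd-n≡2 : ∀ {m n N} (C : Fin N → SubsetIZ m (suc n)) (ooc : IsOOC m (suc n) 3 N C)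
                    h (n≡h+h : suc n ≡ h + h) →
                    suc n ≡ 2 → let open Counting C ooc h n≡h+h in
                    ∑³ uncovered ≡ 4 → ∑³ (λ i j d → uncovered i j d * odd d) ≡ 2
uncovered-odd-n≡2 C ooc h n≡h+h refl =
  odd-pairs uncovered uncovered≤1 uncovered-symmetric outDegree-uncovered-even no-loops
  where
  open Counting C ooc h n≡h+h
  one≡half : fsuc fzero ≡ half
  one≡half = toℕ-injective (sym (trans toℕ-half (double-injective h 1 (sym n≡h+h))))
  no-loops : ∀ i d → uncovered i i d ≡ 0
  no-loops i fzero        = uncovered-loop-zero i
  no-loops i (fsuc fzero) = subst (λ d → uncovered i i d ≡ 0) (sym one≡half) (uncovered-loop-half i)

-- The bound J*

[a+a∸1]/2≡a∸1 : ∀ a → 0 < a → (a + a ∸ 1) / 2 ≡ a ∸ 1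
[a+a∸1]/2≡a∸1 (suc b) _ = begin
  (b + suc b) / 2         ≡⟨ cong (_/ 2) (rearrange b) ⟩
  (1 + b * 2) / 2         ≡⟨ +-distrib-/ 1 (b * 2) (subst (λ r → 1 + r < 2) (sym (m*n%n≡0 b 2)) ≤-refl) ⟩
  0 + b * 2 / 2           ≡⟨ m*n/n≡m b 2 ⟩
  b                       ∎
  where
  rearrange : ∀ b → b + suc b ≡ 1 + b * 2
  rearrange = solve-∀

J-even : ∀ m h → 0 < m * h → J m (h + h) ≡ m * (m * h ∸ 1) / 3
J-even m h 0<mh = cong (λ r → m * r / 3) (begin
  (m * (h + h) ∸ 1) / 2         ≡⟨ cong (λ r → (r ∸ 1) / 2) (*-distribˡ-+ m h h) ⟩
  (m * h + m * h ∸ 1) / 2       ≡⟨ [a+a∸1]/2≡a∸1 (m * h) 0<mh ⟩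
  m * h ∸ 1                     ∎)

-- exceptional m n ≡ exceptionalBy (m * n % 24) (m % 6) (m % 12) (m % 3) (n ≡ᵇ 4) (n ≡ᵇ 2) by refl.
exceptionalBy : (mn%24 m%6 m%12 m%3 : ℕ) (n≡4 n≡2 : Bool) → Bool
exceptionalBy mn%24 m%6 m%12 m%3 n≡4 n≡2 =
  ((mn%24 ≡ᵇ 14) ∨ (mn%24 ≡ᵇ 20))
  ∨ ((m%6 ≡ᵇ 4) ∧ n≡4)
  ∨ (((m%12 ≡ᵇ 5) ∨ (m%12 ≡ᵇ 8)) ∧ n≡2)
  ∨ ((m%3 ≡ᵇ 0) ∧ ((mn%24 ≡ᵇ 6) ∨ (mn%24 ≡ᵇ 12)))

exceptional-residues : ∀ m h → exceptional m (h + h) ≡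
  exceptionalBy (m % 12 * (h % 12) % 12 * 2) (m % 12 % 6) (m % 12) (m % 12 % 3) (h + h ≡ᵇ 4) (h + h ≡ᵇ 2)
exceptional-residues m h =
  trans (cong₂ (λ a b → exceptionalBy a b (m % 12) (m % 3) n≡4 n≡2) mn%24 (residue 6 (divides 2 refl)))
        (cong (λ c → exceptionalBy (m % 12 * (h % 12) % 12 * 2) (m % 12 % 6) (m % 12) c n≡4 n≡2)
              (residue 3 (divides 4 refl)))
  where
  n≡4 n≡2 : Bool
  n≡4 = h + h ≡ᵇ 4
  n≡2 = h + h ≡ᵇ 2
  residue : ∀ d .{{_ : NonZero d}} → d ∣ 12 → m % d ≡ m % 12 % d
  residue d d∣12 = sym (m∣n⇒o%n%m≡o%m d 12 m d∣12)
  mn%24 : m * (h + h) % 24 ≡ m % 12 * (h % 12) % 12 * 2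
  mn%24 = begin
    m * (h + h) % 24          ≡⟨ cong (_% 24) (double m h) ⟩
    m * h * 2 % (12 * 2)      ≡⟨ m%n*o≡m*o%[n*o] (m * h) 12 2 ⟨
    m * h % 12 * 2            ≡⟨ cong (_* 2) (%-distribˡ-* m h 12) ⟩
    m % 12 * (h % 12) % 12 * 2 ∎
    where
    double : ∀ m h → m * (h + h) ≡ m * h * 2
    double = solve-∀

Bool-all? : {P : Bool → Set} → (∀ b → Dec (P b)) → Dec (∀ b → P b)
Bool-all? P? with P? true | P? false
... | yes p | yes q = yes λ { true → p ; false → q }
... | no ¬p | _     = no λ all → ¬p (all true)
... | _     | no ¬q = no λ all → ¬q (all false)

-- What a code of size exactly J m n would force on r = m mod 12, t = h mod 12 (n = 2h),
-- x = (m (mh - 1)) mod 3 (the uncovered count is 2x) and o (the uncovered odd differences).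
Residues : (r t x o : ℕ) (n≡4 n≡2 : Bool) → Set
Residues r t x o n≡4 n≡2 =
  T (exceptionalBy (r * t % 12 * 2) (r % 6) r (r % 3) n≡4 n≡2) ×
  (x + r) % 3 ≡ r * (r * t) % 3 ×
  (o + r * (t % 2)) % 4 ≡ r * (r * t) % 4 ×
  o ≤ x + x ×
  (T n≡4 → t ≡ 2 × (x + x ≡ 2 → o ≡ 2)) ×
  (T n≡2 → t ≡ 1 × (x + x ≡ 4 → o ≡ 2))

residues? : ∀ r t x o n≡4 n≡2 → Dec (Residues r t x o n≡4 n≡2)
residues? r t x o n≡4 n≡2 =
  T? _ ×-dec (_ ≟ _) ×-dec (_ ≟ _) ×-dec (o ≤? x + x) ×-dec
  (T? n≡4 →-dec ((t ≟ 2) ×-dec ((x + x ≟ 2) →-dec (o ≟ 2)))) ×-dec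
  (T? n≡2 →-dec ((t ≟ 1) ×-dec ((x + x ≟ 4) →-dec (o ≟ 2))))

residues-impossible : ∀ {r} → r < 12 → ∀ {t} → t < 12 → ∀ {x} → x < 3 → ∀ {o} → o < 5 →
                      ∀ n≡4 n≡2 → ¬ Residues r t x o n≡4 n≡2
residues-impossible = from-yes
  (allUpTo? (λ r → allUpTo? (λ t → allUpTo? (λ x → allUpTo? (λ o →
     Bool-all? (λ n≡4 → Bool-all? (λ n≡2 → ¬? (residues? r t x o n≡4 n≡2)))) 5) 3) 12) 12)

module _ {m h N ℓ o c : ℕ} (0<m : 0 < m) (0<h : 0 < h)
         (total : ℓ + N * 6 + (m + m) ≡ m * (m * (h + h)))
         (odd-total : o + c + m * (h % 2) ≡ m * (m * h)) (4∣c : 4 ∣ c) (o≤ℓ : o ≤ ℓ)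
         (n≡4⇒o≡2 : h + h ≡ 4 → ℓ ≡ 2 → o ≡ 2) (n≡2⇒o≡2 : h + h ≡ 2 → ℓ ≡ 4 → o ≡ 2) where

  private
    0<mh : 0 < m * h
    0<mh = *-mono-≤ 0<m 0<h

    W : ℕ
    W = m * (m * h ∸ 1)

    mmh≡m+W : m * (m * h) ≡ m + W
    mmh≡m+W = trans (cong (m *_) (sym (m+[n∸m]≡n 0<mh))) (*-suc m (m * h ∸ 1))

    J≡W/3 : J m (h + h) ≡ W / 3
    J≡W/3 = J-even m h 0<mh

    ℓ+6N≡W+W : ℓ + N * 6 ≡ W + W
    ℓ+6N≡W+W = +-cancelʳ-≡ (m + m) (ℓ + N * 6) (W + W) (begin
      ℓ + N * 6 + (m + m)         ≡⟨ total ⟩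
      m * (m * (h + h))           ≡⟨ double m h ⟩
      m * (m * h) + m * (m * h)   ≡⟨ cong (λ v → v + v) mmh≡m+W ⟩
      m + W + (m + W)             ≡⟨ shuffle m W ⟩
      W + W + (m + m)             ∎)
      where
      double : ∀ m h → m * (m * (h + h)) ≡ m * (m * h) + m * (m * h)
      double = solve-∀
      shuffle : ∀ m W → m + W + (m + W) ≡ W + W + (m + m)
      shuffle = solve-∀

    N≤J : N ≤ J m (h + h)
    N≤J = subst (N ≤_) (sym J≡W/3) (subst (_≤ W / 3) (m*n/n≡m N 3) (/-monoˡ-≤ 3 3N≤W))
      where
      3N≤W : N * 3 ≤ W
      3N≤W = *-cancelʳ-≤ (N * 3) W 2
               (subst₂ _≤_ (sym (*-assoc N 3 2)) (trans ℓ+6N≡W+W (a+a≡a*2 W)) (m≤n+m (N * 6) ℓ))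

    ℓ≡x+x : N ≡ J m (h + h) → ℓ ≡ W % 3 + W % 3
    ℓ≡x+x N≡J = +-cancelʳ-≡ (N * 6) ℓ (W % 3 + W % 3) (begin
      ℓ + N * 6                               ≡⟨ ℓ+6N≡W+W ⟩
      W + W                                   ≡⟨ cong (λ w → w + w) W≡x+3N ⟩
      W % 3 + N * 3 + (W % 3 + N * 3)         ≡⟨ rearrange (W % 3) N ⟩
      W % 3 + W % 3 + N * 6                   ∎)
      where
      W≡x+3N : W ≡ W % 3 + N * 3
      W≡x+3N = trans (m≡m%n+[m/n]*n W 3) (cong (λ q → W % 3 + q * 3) (sym (trans N≡J J≡W/3)))
      rearrange : ∀ x N → x + N * 3 + (x + N * 3) ≡ x + x + N * 6
      rearrange = solve-∀

    o<5 : N ≡ J m (h + h) → o < 5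
    o<5 N≡J = s≤s (≤-trans o≤ℓ (≤-trans (≤-reflexive (ℓ≡x+x N≡J))
                                        (+-mono-≤ (≤-pred (m%n<n W 3)) (≤-pred (m%n<n W 3)))))

    r t : ℕ
    r = m % 12
    t = h % 12

    m≡r : ∀ d .{{_ : NonZero d}} → d ∣ 12 → m % d ≡ r % d
    m≡r d d∣12 = sym (m∣n⇒o%n%m≡o%m d 12 m d∣12)

    h≡t : ∀ d .{{_ : NonZero d}} → d ∣ 12 → h % d ≡ t % d
    h≡t d d∣12 = sym (m∣n⇒o%n%m≡o%m d 12 h d∣12)

    mmh≡rrt : ∀ d .{{_ : NonZero d}} → d ∣ 12 → m * (m * h) % d ≡ r * (r * t) % d
    mmh≡rrt d d∣12 =
      %-cong-* {m} {r} {m * h} {r * t} d (m≡r d d∣12) (%-cong-* {m} {r} {h} {t} d (m≡r d d∣12) (h≡t d d∣12))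

    extremal-residues : N ≡ J m (h + h) → T (exceptional m (h + h)) →
                        Residues r t (W % 3) o (h + h ≡ᵇ 4) (h + h ≡ᵇ 2)
    extremal-residues N≡J exc =
        subst T (exceptional-residues m h) exc
      , (begin
          (W % 3 + r) % 3          ≡⟨ %-cong-+ {W % 3} {W} {r} {m} 3 (m%n%n≡m%n W 3) (sym (m≡r 3 (divides 4 refl))) ⟩
          (W + m) % 3              ≡⟨ cong (_% 3) (trans (+-comm W m) (sym mmh≡m+W)) ⟩
          m * (m * h) % 3          ≡⟨ mmh≡rrt 3 (divides 4 refl) ⟩
          r * (r * t) % 3          ∎)
      , (begin
          (o + r * (t % 2)) % 4
            ≡⟨ %-cong-+ {o} {o} 4 refl (%-cong-* {r} {m} {t % 2} {h % 2} 4 (sym (m≡r 4 (divides 3 refl)))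
                                                                              (cong (_% 4) (sym (h≡t 2 (divides 6 refl))))) ⟩
          (o + m * (h % 2)) % 4
            ≡⟨ %-remove-+ʳ (o + m * (h % 2)) 4∣c ⟨
          (o + m * (h % 2) + c) % 4
            ≡⟨ cong (_% 4) (trans (swap o (m * (h % 2)) c) odd-total) ⟩
          m * (m * h) % 4
            ≡⟨ mmh≡rrt 4 (divides 3 refl) ⟩
          r * (r * t) % 4
            ∎)
      , ≤-trans o≤ℓ (≤-reflexive (ℓ≡x+x N≡J))
      , (λ n≡4 → let h≡2 = double-injective h 2 (≡ᵇ⇒≡ (h + h) 4 n≡4) in
                  cong (_% 12) h≡2 , λ x+x≡2 → n≡4⇒o≡2 (cong (λ a → a + a) h≡2) (trans (ℓ≡x+x N≡J) x+x≡2))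
      , (λ n≡2 → let h≡1 = double-injective h 1 (≡ᵇ⇒≡ (h + h) 2 n≡2) in
                  cong (_% 12) h≡1 , λ x+x≡4 → n≡2⇒o≡2 (cong (λ a → a + a) h≡1) (trans (ℓ≡x+x N≡J) x+x≡4))
      where
      swap : ∀ a b c → a + b + c ≡ a + c + b
      swap = solve-∀

  N≤Jstar : N ≤ Jstar m (h + h)
  N≤Jstar with exceptional m (h + h) in exc | N ≟ J m (h + h)
  ... | false | _       = N≤J
  ... | true  | no N≢J  = ∸-monoˡ-≤ 1 (≤∧≢⇒< N≤J N≢J)
  ... | true  | yes N≡J = ⊥-elim (residues-impossible (m%n<n m 12) (m%n<n h 12) (m%n<n W 3) (o<5 N≡J) _ _
                                   (extremal-residues N≡J (subst T (sym exc) tt)))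

lemma3p4 : (m n : ℕ) → 0 < m → 0 < n → 2 ∣ n →
           (N : ℕ) (C : Fin N → SubsetIZ m n) → IsOOC m n 3 N C →
           N ≤ Jstar m n
lemma3p4 m zero    _   () _ _ _ _
lemma3p4 m (suc n) 0<m _  (divides h n≡h*2) N C ooc =
  subst (λ k → N ≤ Jstar m k) (sym n≡h+h)
    (N≤Jstar 0<m 0<h uncovered-total uncovered-odd-total 4∣covered-odd uncovered-odd≤uncovered
             (λ h+h≡4 → uncovered-odd-n≡4 C ooc h n≡h+h (trans n≡h+h h+h≡4))
             (λ h+h≡2 → uncovered-odd-n≡2 C ooc h n≡h+h (trans n≡h+h h+h≡2)))
  where
  n≡h+h : suc n ≡ h + h
  n≡h+h = trans n≡h*2 (sym (a+a≡a*2 h))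
  open Counting C ooc h n≡h+h
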